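{- Let $n\ge 2$ and $1\le k<n$. Let $G$ be the graph with vertex set $V=\{x\in\{0,1\}^n:\sum_i x_i=k\}$, where $x\sim y$ iff $|\mathrm{supp}(x-y)|=2$. Then $\mathrm{Ric}(G)=1+\frac n2$.
   Context: For a graph $G=(V,E)$ (undirected, simple, locally finite, no isolated vertices; $y\sim x$ means adjacency) and $f,g:V\to\mathbb R$ define $\Delta f(x)=\sum_{y\sim x}(f(y)-f(x))$, $\Gamma(f,g)(x)=\frac12\sum_{y\sim x}(f(x)-f(y))(g(x)-g(y))$, $\Gamma(f)=\Gamma(f,f)$, $\Gamma_2(f)=\frac12\Delta\Gamma(f)-\Gamma(f,\Delta f)$. The curvature $\mathrm{Ric}(G)$ is the largest $K\in\mathbb R$ such that $\Gamma_2(f)(x)\ge K\,\Gamma(f)(x)$ for all $f:V\to\mathbb R$ and all $x\in V$.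
   Formalization: The functions f take values in ℚ, and the constants K in the definition of Ric(G), including those competing for the largest, range over ℚ rather than ℝ. -}

module Defs where

open import Data.Bool using (Bool; true; false; if_then_else_)
open import Data.Nat as ℕ using (ℕ; zero; suc)
open import Data.Integer using (+_)
open import Data.Rational using (ℚ; 0ℚ; 1ℚ; ½; _+_; _-_; _*_; _/_; _≤_)
open import Data.Vec using (Vec; []; _∷_)
open import Data.List using (List; []; _∷_; _++_; map; foldr)
open import Data.Product using (Σ; _,_; _×_; proj₁)
open import Relation.Binary.PropositionalEquality using (_≡_)
open import Relation.Nullary using (yes; no)

record Graph : Set₁ where
  field
    V    : Set
    nbrs : V → List V     -- y ∼ x  iff  y ∈ nbrs x (each neighbour once)

sumℚ : List ℚ → ℚ
sumℚ = foldr _+_ 0ℚ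

module _ (G : Graph) where
  open Graph G

  Δ : (V → ℚ) → V → ℚ
  Δ f x = sumℚ (map (λ y → f y - f x) (nbrs x))

  Γ₁ : (V → ℚ) → (V → ℚ) → V → ℚ
  Γ₁ f g x = ½ * sumℚ (map (λ y → (f x - f y) * (g x - g y)) (nbrs x))

  Γ : (V → ℚ) → V → ℚ
  Γ f = Γ₁ f f

  Γ₂ : (V → ℚ) → V → ℚ
  Γ₂ f x = ½ * Δ (Γ f) x - Γ₁ f (Δ f) x

  CD : ℚ → Set
  CD K = (f : V → ℚ) (x : V) → K * Γ f x ≤ Γ₂ f x

  IsRic : ℚ → Set
  IsRic K = CD K × ((K' : ℚ) → CD K' → K' ≤ K)

weight : ∀ {n} → Vec Bool n → ℕ
weight [] = 0
weight (b ∷ v) = (if b then 1 else 0) ℕ.+ weight v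

diffCount : ∀ {n} → Vec Bool n → Vec Bool n → ℕ
diffCount [] [] = 0
diffCount (true ∷ x) (false ∷ y) = suc (diffCount x y)
diffCount (false ∷ x) (true ∷ y) = suc (diffCount x y)
diffCount (true ∷ x) (true ∷ y) = diffCount x y
diffCount (false ∷ x) (false ∷ y) = diffCount x y

allVecs : (n : ℕ) → List (Vec Bool n)
allVecs zero = [] ∷ []
allVecs (suc n) = map (true ∷_) (allVecs n) ++ map (false ∷_) (allVecs n)

Vertex : ℕ → ℕ → Set
Vertex n k = Σ (Vec Bool n) (λ x → weight x ≡ k)

selectNbrs : ∀ {n} k → Vec Bool n → List (Vec Bool n) → List (Vertex n k)
selectNbrs k x [] = []
selectNbrs k x (y ∷ ys) with weight y ℕ.≟ k | diffCount x y ℕ.≟ 2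
... | yes p | yes _ = (y , p) ∷ selectNbrs k x ys
... | yes _ | no _  = selectNbrs k x ys
... | no _  | _     = selectNbrs k x ys

J : ℕ → ℕ → Graph
J n k = record
  { V    = Vertex n k
  ; nbrs = λ v → selectNbrs k (proj₁ v) (allVecs n)
  }

-- On a regular graph, 4Γ₂(f)(x) = Σ_{y∼x} Σ_{z∼y} (f z − 2 f y + f x)² − Σ_{y,y′∼x} (f y − f y′)².
-- In J(n,k) the neighbours of x are the swaps Y_pq of a one p with a zero q of x, and the neighbours
-- of Y_pq are x, the Y_pq′, the Y_p′q and the vertices Z reached by two disjoint swaps. Writing a_pq
-- for f(Y_pq) − f(x) and W for f(Z) − f(x), the difference 4Γ₂(f) − (2 + n)·2Γ(f) becomes a sum of
-- squares: the row and column variations (a_pq − a_pq′)² and (a_pq − a_p′q)², the deviations of W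
-- from the mean of the four increments around Z, and a quarter of the mixed differences
-- a_pq − a_pq′ − a_p′q + a_p′q′. Hence Γ₂ ≥ (1 + n/2) Γ. For the Hamming distance from a vertex all
-- these squares vanish while Γ > 0, so 1 + n/2 cannot be improved.

module Submission where

open import Algebra.Bundles using (CommutativeRing)
open import Data.Bool using (Bool; true; false; not; if_then_else_; _xor_)
open import Data.Bool.Properties using (xor-same)
open import Data.Fin using (Fin; zero; suc; _≟_)
import Data.Integer as ℤ
import Data.Integer.Properties as ℤ
open import Data.List using (List; []; _∷_; _++_; map)
open import Data.Nat as ℕ using (ℕ; zero; suc; _≡ᵇ_; z≤n; s≤s)
import Data.Nat.Properties as ℕₚ
open import Data.Product using (_,_; proj₁)
open import Data.Rational
  using (ℚ; 0ℚ; 1ℚ; ½; _+_; _-_; _*_; -_; _/_; _≤_; _<_; toℚᵘ; positive; nonNegative; nonPositive)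
import Data.Rational.Properties as ℚ
open import Data.Rational.Solver using (module +-*-Solver)
import Data.Rational.Unnormalised as ℚᵘ
import Data.Rational.Unnormalised.Properties as ℚᵘ
open import Data.Sum using (inj₁; inj₂)
open import Data.Vec using (Vec; []; _∷_; lookup; _[_]≔_)
open import Data.Vec.Properties using (lookup∘update; lookup∘update′)
open import Data.Vec.Relation.Binary.Pointwise.Extensional using (ext; Pointwise-≡⇒≡)
open import Function using (_∘_)
open import Relation.Binary.PropositionalEquality hiding (J)
open import Relation.Nullary using (yes; no; contradiction)
open import Relation.Nullary.Decidable using (does; dec-true; dec-false)

open import Algebra.Properties.CommutativeSemigroup ℕₚ.+-commutativeSemigroup using (x∙yz≈y∙xz)
open import Algebra.Properties.Semiring.Sum (CommutativeRing.semiring ℚ.+-*-commutativeRing)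
  using (sum; sum-syntax; sum-cong-≗; ∑-distrib-+; ∑-comm; *-distribˡ-sum; *-distribʳ-sum; sum-replicate-zero)

open import Defs

open +-*-Solver hiding (⟦_⟧)

-- Rational arithmetic and Iverson brackets

2ℚ 4ℚ ¼ : ℚ
2ℚ = ℤ.+ 2 / 1
4ℚ = ℤ.+ 4 / 1
¼  = ℤ.+ 1 / 4

infixl 10 _²

_² : ℚ → ℚ
a ² = a * a

⟦_⟧ : Bool → ℚ
⟦ true ⟧  = 1ℚ
⟦ false ⟧ = 0ℚ

not≡true⇒≡false : ∀ {b} → not b ≡ true → b ≡ false
not≡true⇒≡false {false} _ = refl

⟦⟧-idem : ∀ b → ⟦ b ⟧ * ⟦ b ⟧ ≡ ⟦ b ⟧
⟦⟧-idem true  = refl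
⟦⟧-idem false = refl

⟦not⟧ : ∀ b → ⟦ not b ⟧ ≡ 1ℚ - ⟦ b ⟧
⟦not⟧ true  = refl
⟦not⟧ false = refl

⟦⟧-nonneg : ∀ b → 0ℚ ≤ ⟦ b ⟧
⟦⟧-nonneg true  = ℚ.nonNegative⁻¹ 1ℚ
⟦⟧-nonneg false = ℚ.≤-refl

⟦⟧*-cong : ∀ b {X Y} → (b ≡ true → X ≡ Y) → ⟦ b ⟧ * X ≡ ⟦ b ⟧ * Y
⟦⟧*-cong true  X≡Y = cong (1ℚ *_) (X≡Y refl)
⟦⟧*-cong false {X} {Y} _ = trans (ℚ.*-zeroˡ X) (sym (ℚ.*-zeroˡ Y))

⟦⟧²*-cong : ∀ b c {X Y} → (b ≡ true → c ≡ true → X ≡ Y) → ⟦ b ⟧ * ⟦ c ⟧ * X ≡ ⟦ b ⟧ * ⟦ c ⟧ * Y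
⟦⟧²*-cong b c {X} {Y} X≡Y = begin
  ⟦ b ⟧ * ⟦ c ⟧ * X    ≡⟨ ℚ.*-assoc ⟦ b ⟧ ⟦ c ⟧ X ⟩
  ⟦ b ⟧ * (⟦ c ⟧ * X)  ≡⟨ ⟦⟧*-cong b (λ b≡true → ⟦⟧*-cong c (X≡Y b≡true)) ⟩
  ⟦ b ⟧ * (⟦ c ⟧ * Y)  ≡⟨ ℚ.*-assoc ⟦ b ⟧ ⟦ c ⟧ Y ⟨
  ⟦ b ⟧ * ⟦ c ⟧ * Y    ∎
  where open ≡-Reasoning

⟦⟧*-zero : ∀ b {X} → (b ≡ true → X ≡ 0ℚ) → ⟦ b ⟧ * X ≡ 0ℚ
⟦⟧*-zero b {X} X≡0 = trans (⟦⟧*-cong b X≡0) (ℚ.*-zeroʳ ⟦ b ⟧)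

+-identityˡ′ : ∀ {a} b → a ≡ 0ℚ → a + b ≡ b
+-identityˡ′ b refl = ℚ.+-identityˡ b

+-identityʳ′ : ∀ a {b} → b ≡ 0ℚ → a + b ≡ a
+-identityʳ′ a refl = ℚ.+-identityʳ a

0*x*y≡0 : ∀ a b → 0ℚ * a * b ≡ 0ℚ
0*x*y≡0 a b = trans (cong (_* b) (ℚ.*-zeroˡ a)) (ℚ.*-zeroˡ b)

x*0*y≡0 : ∀ a b → a * 0ℚ * b ≡ 0ℚ
x*0*y≡0 a b = trans (cong (_* b) (ℚ.*-zeroʳ a)) (ℚ.*-zeroˡ b)

²-nonneg : ∀ a → 0ℚ ≤ a ²
²-nonneg a with ℚ.≤-total 0ℚ a
... | inj₁ 0≤a = ℚ.nonNegative⁻¹ _ {{ℚ.nonNeg*nonNeg⇒nonNeg a {{nonNegative 0≤a}} a {{nonNegative 0≤a}}}}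
... | inj₂ a≤0 = ℚ.nonNegative⁻¹ _ {{ℚ.nonPos*nonPos⇒nonPos a {{nonPositive a≤0}} a {{nonPositive a≤0}}}}

*-nonneg : ∀ {a b} → 0ℚ ≤ a → 0ℚ ≤ b → 0ℚ ≤ a * b
*-nonneg {a} {b} 0≤a 0≤b = ℚ.nonNegative⁻¹ _ {{ℚ.nonNeg*nonNeg⇒nonNeg a {{nonNegative 0≤a}} b {{nonNegative 0≤b}}}}

*-pos : ∀ {a b} → 0ℚ < a → 0ℚ < b → 0ℚ < a * b
*-pos {a} {b} 0<a 0<b = ℚ.positive⁻¹ _ {{ℚ.pos*pos⇒pos a {{positive 0<a}} b {{positive 0<b}}}}

4*-injective : ∀ {X Y} → 4ℚ * X ≡ 4ℚ * Y → X ≡ Y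
4*-injective {X} {Y} 4X≡4Y = begin
  X             ≡⟨ solve 1 (λ X → X := con ¼ :* (con 4ℚ :* X)) refl X ⟩
  ¼ * (4ℚ * X)  ≡⟨ cong (¼ *_) 4X≡4Y ⟩
  ¼ * (4ℚ * Y)  ≡⟨ solve 1 (λ Y → con ¼ :* (con 4ℚ :* Y) := Y) refl Y ⟩
  Y             ∎
  where open ≡-Reasoning

≤-from-gap : ∀ {X Y} → 0ℚ ≤ 4ℚ * Y - 4ℚ * X → X ≤ Y
≤-from-gap {X} {Y} 0≤gap = subst₂ _≤_ (ℚ.+-identityʳ X)
  (solve 2 (λ X Y → X :+ con ¼ :* (con 4ℚ :* Y :- con 4ℚ :* X) := Y) refl X Y)
  (ℚ.+-monoʳ-≤ X (*-nonneg (ℚ.nonNegative⁻¹ ¼) 0≤gap))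

≡-from-gap : ∀ {X Y} → 4ℚ * Y - 4ℚ * X ≡ 0ℚ → Y ≡ X
≡-from-gap {X} {Y} gap≡0 = begin
  Y                               ≡⟨ solve 2 (λ X Y → Y := X :+ con ¼ :* (con 4ℚ :* Y :- con 4ℚ :* X)) refl X Y ⟩
  X + ¼ * (4ℚ * Y - 4ℚ * X)       ≡⟨ cong (λ g → X + ¼ * g) gap≡0 ⟩
  X + ¼ * 0ℚ                      ≡⟨ ℚ.+-identityʳ X ⟩
  X                               ∎
  where open ≡-Reasoning

fromℕ : ℕ → ℚ
fromℕ zero    = 0ℚ
fromℕ (suc m) = 1ℚ + fromℕ m

fromℕ-nonneg : ∀ m → 0ℚ ≤ fromℕ m
fromℕ-nonneg zero    = ℚ.≤-refl
fromℕ-nonneg (suc m) = ℚ.+-mono-≤ (ℚ.nonNegative⁻¹ 1ℚ) (fromℕ-nonneg m)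

fromℕ-pos : ∀ m → 0ℚ < fromℕ (suc m)
fromℕ-pos m = ℚ.+-mono-<-≤ (ℚ.positive⁻¹ 1ℚ) (fromℕ-nonneg m)

fromℕ-diff-pos : ∀ {k n} → k ℕ.< n → 0ℚ < fromℕ n - fromℕ k
fromℕ-diff-pos {zero}  {suc n} _         = subst (0ℚ <_) (sym (ℚ.+-identityʳ (fromℕ (suc n)))) (fromℕ-pos n)
fromℕ-diff-pos {suc k} {suc n} (s≤s k<n) = subst (0ℚ <_)
  (solve 2 (λ a b → a :- b := (con 1ℚ :+ a) :- (con 1ℚ :+ b)) refl (fromℕ n) (fromℕ k)) (fromℕ-diff-pos k<n)

fromℕ≃ᵘ : ∀ n → toℚᵘ (fromℕ n) ℚᵘ.≃ ℚᵘ.mkℚᵘ (ℤ.+ n) 0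
fromℕ≃ᵘ zero    = ℚᵘ.*≡* refl
fromℕ≃ᵘ (suc n) = begin
  toℚᵘ (1ℚ + fromℕ n)               ≈⟨ ℚ.toℚᵘ-homo-+ 1ℚ (fromℕ n) ⟩
  toℚᵘ 1ℚ ℚᵘ.+ toℚᵘ (fromℕ n)      ≈⟨ ℚᵘ.+-congʳ (toℚᵘ 1ℚ) (fromℕ≃ᵘ n) ⟩
  toℚᵘ 1ℚ ℚᵘ.+ ℚᵘ.mkℚᵘ (ℤ.+ n) 0   ≈⟨ ℚᵘ.*≡* cross ⟩
  ℚᵘ.mkℚᵘ (ℤ.+ suc n) 0             ∎
  where
  open ℚᵘ.≃-Reasoning
  cross : (ℤ.+ 1 ℤ.* ℤ.+ 1 ℤ.+ ℤ.+ n ℤ.* ℤ.+ 1) ℤ.* ℤ.+ 1 ≡ ℤ.+ suc n ℤ.* (ℤ.+ 1 ℤ.* ℤ.+ 1)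
  cross = trans (ℤ.*-identityʳ _) (trans (cong (ℤ._+_ (ℤ.+ 1)) (ℤ.*-identityʳ (ℤ.+ n))) (sym (ℤ.*-identityʳ (ℤ.+ suc n))))

-- (ℤ.+ n) / 2 unfolds to fromℚᵘ (mkℚᵘ (ℤ.+ n) 1).
2*n/2≡n : ∀ n → 2ℚ * ((ℤ.+ n) / 2) ≡ fromℕ n
2*n/2≡n n = ℚ.toℚᵘ-injective (begin
  toℚᵘ (2ℚ * ((ℤ.+ n) / 2))         ≈⟨ ℚ.toℚᵘ-homo-* 2ℚ ((ℤ.+ n) / 2) ⟩
  toℚᵘ 2ℚ ℚᵘ.* toℚᵘ ((ℤ.+ n) / 2)  ≈⟨ ℚᵘ.*-congˡ {toℚᵘ 2ℚ} (ℚ.toℚᵘ-fromℚᵘ (ℚᵘ.mkℚᵘ (ℤ.+ n) 1)) ⟩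
  toℚᵘ 2ℚ ℚᵘ.* ℚᵘ.mkℚᵘ (ℤ.+ n) 1   ≈⟨ ℚᵘ.*≡* (trans (ℤ.*-identityʳ _) (ℤ.*-comm (ℤ.+ 2) (ℤ.+ n))) ⟩
  ℚᵘ.mkℚᵘ (ℤ.+ n) 0                 ≈⟨ fromℕ≃ᵘ n ⟨
  toℚᵘ (fromℕ n)                    ∎)
  where open ℚᵘ.≃-Reasoning

4*[1+n/2]*½≡2+n : ∀ n A → 4ℚ * ((1ℚ + (ℤ.+ n) / 2) * (½ * A)) ≡ (2ℚ + fromℕ n) * A
4*[1+n/2]*½≡2+n n A = trans
  (solve 2 (λ h A → con 4ℚ :* ((con 1ℚ :+ h) :* (con ½ :* A)) := (con 2ℚ :+ con 2ℚ :* h) :* A) refl ((ℤ.+ n) / 2) A)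
  (cong (λ t → (2ℚ + t) * A) (2*n/2≡n n))

-- Finite sums

module _ {n : ℕ} where

  δ δᶜ : Fin n → Fin n → ℚ
  δ  i j = ⟦ does (i ≟ j) ⟧
  δᶜ i j = ⟦ not (does (i ≟ j)) ⟧

  δᶜ≡1-δ : ∀ i j → δᶜ i j ≡ 1ℚ - δ i j
  δᶜ≡1-δ i j = ⟦not⟧ (does (i ≟ j))

  δᶜ-sym : ∀ i j → δᶜ i j ≡ δᶜ j i
  δᶜ-sym i j with i ≟ j
  ... | yes refl = cong (⟦_⟧ ∘ not) (sym (dec-true (i ≟ i) refl))
  ... | no i≢j   = cong (⟦_⟧ ∘ not) (sym (dec-false (j ≟ i) (i≢j ∘ sym)))

not-does⇒≢ : ∀ {n} {i j : Fin n} → not (does (i ≟ j)) ≡ true → i ≢ j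
not-does⇒≢ {i = i} {j} h i≡j with () ← trans (sym (cong not (dec-true (i ≟ j) i≡j))) h

∑-distrib-sub : ∀ {n} (g h : Fin n → ℚ) → ∑[ i < n ] (g i - h i) ≡ sum g - sum h
∑-distrib-sub {zero}  g h = refl
∑-distrib-sub {suc n} g h = begin
  g zero - h zero + ∑[ i < n ] (g (suc i) - h (suc i))
    ≡⟨ cong ((g zero - h zero) +_) (∑-distrib-sub (g ∘ suc) (h ∘ suc)) ⟩
  g zero - h zero + (sum (g ∘ suc) - sum (h ∘ suc))
    ≡⟨ solve 4 (λ a b c d → (a :- b) :+ (c :- d) := (a :+ c) :- (b :+ d)) refl (g zero) (h zero) _ _ ⟩
  g zero + sum (g ∘ suc) - (h zero + sum (h ∘ suc)) ∎
  where open ≡-Reasoning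

∑-zero : ∀ {n} {g : Fin n → ℚ} → (∀ i → g i ≡ 0ℚ) → sum g ≡ 0ℚ
∑-zero {n} g≡0 = trans (sum-cong-≗ g≡0) (sum-replicate-zero n)

∑-δ : ∀ {n} (i : Fin n) (g : Fin n → ℚ) → ∑[ j < n ] (δ i j * g j) ≡ g i
∑-δ {suc n} zero g = begin
  1ℚ * g zero + ∑[ j < n ] (0ℚ * g (suc j))
    ≡⟨ cong₂ _+_ (ℚ.*-identityˡ (g zero)) (trans (sum-cong-≗ (ℚ.*-zeroˡ ∘ g ∘ suc)) (sum-replicate-zero n)) ⟩
  g zero + 0ℚ
    ≡⟨ ℚ.+-identityʳ (g zero) ⟩
  g zero ∎
  where open ≡-Reasoning
∑-δ {suc n} (suc i) g = begin
  0ℚ * g zero + ∑[ j < n ] (δ i j * g (suc j))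
    ≡⟨ cong₂ _+_ (ℚ.*-zeroˡ (g zero)) (∑-δ i (g ∘ suc)) ⟩
  0ℚ + g (suc i)
    ≡⟨ ℚ.+-identityˡ (g (suc i)) ⟩
  g (suc i) ∎
  where open ≡-Reasoning

∑-δ₁ : ∀ {n} (i : Fin n) → ∑[ j < n ] δ i j ≡ 1ℚ
∑-δ₁ i = trans (sum-cong-≗ λ j → sym (ℚ.*-identityʳ (δ i j))) (∑-δ i (λ _ → 1ℚ))

∑-nonneg : ∀ {n} (g : Fin n → ℚ) → (∀ i → 0ℚ ≤ g i) → 0ℚ ≤ sum g
∑-nonneg {zero}  g g≥0 = ℚ.≤-refl
∑-nonneg {suc n} g g≥0 = ℚ.+-mono-≤ (g≥0 zero) (∑-nonneg (g ∘ suc) (g≥0 ∘ suc))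

∑-1 : ∀ n → ∑[ i < n ] 1ℚ ≡ fromℕ n
∑-1 zero    = refl
∑-1 (suc n) = cong (1ℚ +_) (∑-1 n)

module _ {n : ℕ} where

  ∑² : (Fin n → Fin n → ℚ) → ℚ
  ∑² g = ∑[ p < n ] ∑[ q < n ] g p q

  ∑³ : (Fin n → Fin n → Fin n → ℚ) → ℚ
  ∑³ g = ∑[ p < n ] ∑² (g p)

  ∑⁴ : (Fin n → Fin n → Fin n → Fin n → ℚ) → ℚ
  ∑⁴ g = ∑[ p < n ] ∑³ (g p)

  ∑²-cong : ∀ {g h} → (∀ p q → g p q ≡ h p q) → ∑² g ≡ ∑² h
  ∑²-cong g≡h = sum-cong-≗ λ p → sum-cong-≗ (g≡h p)

  ∑³-cong : ∀ {g h} → (∀ p q r → g p q r ≡ h p q r) → ∑³ g ≡ ∑³ h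
  ∑³-cong g≡h = sum-cong-≗ λ p → ∑²-cong (g≡h p)

  ∑⁴-cong : ∀ {g h} → (∀ p q r s → g p q r s ≡ h p q r s) → ∑⁴ g ≡ ∑⁴ h
  ∑⁴-cong g≡h = sum-cong-≗ λ p → ∑³-cong (g≡h p)

  ∑²-distrib-+ : ∀ g h → ∑² (λ p q → g p q + h p q) ≡ ∑² g + ∑² h
  ∑²-distrib-+ g h = trans (sum-cong-≗ λ p → ∑-distrib-+ (g p) (h p)) (∑-distrib-+ (sum ∘ g) (sum ∘ h))

  ∑³-distrib-+ : ∀ g h → ∑³ (λ p q r → g p q r + h p q r) ≡ ∑³ g + ∑³ h
  ∑³-distrib-+ g h = trans (sum-cong-≗ λ p → ∑²-distrib-+ (g p) (h p)) (∑-distrib-+ (∑² ∘ g) (∑² ∘ h))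

  ∑⁴-distrib-+ : ∀ g h → ∑⁴ (λ p q r s → g p q r s + h p q r s) ≡ ∑⁴ g + ∑⁴ h
  ∑⁴-distrib-+ g h = trans (sum-cong-≗ λ p → ∑³-distrib-+ (g p) (h p)) (∑-distrib-+ (∑³ ∘ g) (∑³ ∘ h))

  ∑²-distrib-sub : ∀ g h → ∑² (λ p q → g p q - h p q) ≡ ∑² g - ∑² h
  ∑²-distrib-sub g h = trans (sum-cong-≗ λ p → ∑-distrib-sub (g p) (h p)) (∑-distrib-sub (sum ∘ g) (sum ∘ h))

  ∑³-distrib-sub : ∀ g h → ∑³ (λ p q r → g p q r - h p q r) ≡ ∑³ g - ∑³ h
  ∑³-distrib-sub g h = trans (sum-cong-≗ λ p → ∑²-distrib-sub (g p) (h p)) (∑-distrib-sub (∑² ∘ g) (∑² ∘ h))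

  ∑⁴-distrib-sub : ∀ g h → ∑⁴ (λ p q r s → g p q r s - h p q r s) ≡ ∑⁴ g - ∑⁴ h
  ∑⁴-distrib-sub g h = trans (sum-cong-≗ λ p → ∑³-distrib-sub (g p) (h p)) (∑-distrib-sub (∑³ ∘ g) (∑³ ∘ h))

  ∑²-distrib-+₄ : ∀ g₁ g₂ g₃ g₄ →
                  ∑² (λ p q → g₁ p q + g₂ p q + g₃ p q + g₄ p q) ≡ ∑² g₁ + ∑² g₂ + ∑² g₃ + ∑² g₄
  ∑²-distrib-+₄ g₁ g₂ g₃ g₄ =
    trans (∑²-distrib-+ _ g₄) (cong (_+ ∑² g₄) (trans (∑²-distrib-+ _ g₃) (cong (_+ ∑² g₃) (∑²-distrib-+ g₁ g₂))))

  *-distribˡ-∑² : ∀ c g → c * ∑² g ≡ ∑² (λ p q → c * g p q)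
  *-distribˡ-∑² c g = trans (*-distribˡ-sum c (sum ∘ g)) (sum-cong-≗ λ p → *-distribˡ-sum c (g p))

  *-distribˡ-∑³ : ∀ c g → c * ∑³ g ≡ ∑³ (λ p q r → c * g p q r)
  *-distribˡ-∑³ c g = trans (*-distribˡ-sum c (∑² ∘ g)) (sum-cong-≗ λ p → *-distribˡ-∑² c (g p))

  *-distribˡ-∑⁴ : ∀ c g → c * ∑⁴ g ≡ ∑⁴ (λ p q r s → c * g p q r s)
  *-distribˡ-∑⁴ c g = trans (*-distribˡ-sum c (∑³ ∘ g)) (sum-cong-≗ λ p → *-distribˡ-∑³ c (g p))

  ∑³-nonneg : ∀ g → (∀ p q r → 0ℚ ≤ g p q r) → 0ℚ ≤ ∑³ g
  ∑³-nonneg g g≥0 = ∑-nonneg _ λ p → ∑-nonneg _ λ q → ∑-nonneg _ (g≥0 p q)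

  ∑⁴-nonneg : ∀ g → (∀ p q r s → 0ℚ ≤ g p q r s) → 0ℚ ≤ ∑⁴ g
  ∑⁴-nonneg g g≥0 = ∑-nonneg _ λ p → ∑³-nonneg (g p) (g≥0 p)

∑²-suc : ∀ {n} (g : Fin (suc n) → Fin (suc n) → ℚ) →
         ∑² g ≡ g zero zero + ∑[ q < n ] g zero (suc q) + ∑[ p < n ] g (suc p) zero + ∑² (λ p q → g (suc p) (suc q))
∑²-suc {n} g = trans (cong (g zero zero + ∑[ q < n ] g zero (suc q) +_) (∑-distrib-+ (λ p → g (suc p) zero) _))
                     (sym (ℚ.+-assoc (g zero zero + ∑[ q < n ] g zero (suc q)) (∑[ p < n ] g (suc p) zero) _))

module _ {n : ℕ} where

  ∑²-transpose : ∀ (u v : Fin n → ℚ) (g : Fin n → Fin n → ℚ) →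
                 ∑² (λ p q → u p * v q * g p q) ≡ ∑² (λ q p → v q * u p * g p q)
  ∑²-transpose u v g = trans (∑-comm (λ p q → u p * v q * g p q))
                             (∑²-cong λ q p → cong (_* g p q) (ℚ.*-comm (u p) (v q)))

  ∑³-exchange : ∀ g → ∑³ g ≡ ∑³ (λ i j k → g k j i)
  ∑³-exchange g = sym (begin
    ∑[ i < n ] ∑[ j < n ] ∑[ k < n ] g k j i   ≡⟨ sum-cong-≗ (λ i → ∑-comm (λ j k → g k j i)) ⟩
    ∑[ i < n ] ∑[ k < n ] ∑[ j < n ] g k j i   ≡⟨ ∑-comm (λ i k → ∑[ j < n ] g k j i) ⟩
    ∑[ k < n ] ∑[ i < n ] ∑[ j < n ] g k j i   ≡⟨ sum-cong-≗ (λ k → ∑-comm (λ i j → g k j i)) ⟩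
    ∑[ k < n ] ∑[ j < n ] ∑[ i < n ] g k j i   ∎)
    where open ≡-Reasoning

  ∑⁴-exchangeˡ : ∀ h → ∑⁴ h ≡ ∑⁴ (λ p q p′ q′ → h p′ q p q′)
  ∑⁴-exchangeˡ h = ∑³-exchange (λ p q p′ → ∑[ q′ < n ] h p q p′ q′)

  ∑⁴-exchangeʳ : ∀ h → ∑⁴ h ≡ ∑⁴ (λ p q p′ q′ → h p q′ p′ q)
  ∑⁴-exchangeʳ h = sum-cong-≗ λ p → ∑³-exchange (h p)

  symmetrise : ∀ (M F : Fin n → Fin n → Fin n → Fin n → ℚ) →
    (∀ p q p′ q′ → M p′ q p q′ ≡ M p q p′ q′) → (∀ p q p′ q′ → M p q′ p′ q ≡ M p q p′ q′) →
    4ℚ * ∑⁴ (λ p q p′ q′ → M p q p′ q′ * F p q p′ q′)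
    ≡ ∑⁴ (λ p q p′ q′ → M p q p′ q′ * (F p q p′ q′ + F p′ q p q′ + F p q′ p′ q + F p′ q′ p q))
  symmetrise M F M-exˡ M-exʳ = begin
    4ℚ * X                            ≡⟨ solve 1 (λ X → con 4ℚ :* X := X :+ X :+ X :+ X) refl X ⟩
    X + X + X + X                     ≡⟨ cong₂ _+_ (cong₂ _+_ (cong (X +_) Xˡ) Xʳ) Xˡʳ ⟩
    X + ∑⁴ Fˡ + ∑⁴ Fʳ + ∑⁴ Fˡʳ         ≡⟨ distrib ⟨
    ∑⁴ (λ p q p′ q′ → MF p q p′ q′ + Fˡ p q p′ q′ + Fʳ p q p′ q′ + Fˡʳ p q p′ q′)
      ≡⟨ ∑⁴-cong (λ p q p′ q′ →
           solve 5 (λ m f fˡ fʳ fˡʳ → m :* f :+ m :* fˡ :+ m :* fʳ :+ m :* fˡʳ := m :* (f :+ fˡ :+ fʳ :+ fˡʳ))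
                 refl (M p q p′ q′) (F p q p′ q′) (F p′ q p q′) (F p q′ p′ q) (F p′ q′ p q)) ⟩
    ∑⁴ (λ p q p′ q′ → M p q p′ q′ * (F p q p′ q′ + F p′ q p q′ + F p q′ p′ q + F p′ q′ p q)) ∎
    where
    open ≡-Reasoning
    MF Fˡ Fʳ Fˡʳ : Fin n → Fin n → Fin n → Fin n → ℚ
    MF  p q p′ q′ = M p q p′ q′ * F p q p′ q′
    Fˡ  p q p′ q′ = M p q p′ q′ * F p′ q p q′
    Fʳ  p q p′ q′ = M p q p′ q′ * F p q′ p′ q
    Fˡʳ p q p′ q′ = M p q p′ q′ * F p′ q′ p q
    X : ℚ
    X = ∑⁴ MF
    Xˡ : X ≡ ∑⁴ Fˡ
    Xˡ = trans (∑⁴-exchangeˡ MF) (∑⁴-cong λ p q p′ q′ → cong (_* F p′ q p q′) (M-exˡ p q p′ q′))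
    Xʳ : X ≡ ∑⁴ Fʳ
    Xʳ = trans (∑⁴-exchangeʳ MF) (∑⁴-cong λ p q p′ q′ → cong (_* F p q′ p′ q) (M-exʳ p q p′ q′))
    Xˡʳ : X ≡ ∑⁴ Fˡʳ
    Xˡʳ = trans (∑⁴-exchangeʳ MF) (trans (∑⁴-exchangeˡ (λ p q p′ q′ → MF p q′ p′ q))
            (∑⁴-cong λ p q p′ q′ → cong (_* F p′ q′ p q) (trans (M-exˡ p q′ p′ q) (M-exʳ p q p′ q′))))
    distrib : ∑⁴ (λ p q p′ q′ → MF p q p′ q′ + Fˡ p q p′ q′ + Fʳ p q p′ q′ + Fˡʳ p q p′ q′)
              ≡ X + ∑⁴ Fˡ + ∑⁴ Fʳ + ∑⁴ Fˡʳ
    distrib = trans (∑⁴-distrib-+ _ Fˡʳ) (cong (_+ ∑⁴ Fˡʳ)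
                (trans (∑⁴-distrib-+ _ Fʳ) (cong (_+ ∑⁴ Fʳ) (∑⁴-distrib-+ MF Fˡ))))

  ∑²-δ : ∀ i (X : Fin n → Fin n → ℚ) → ∑² (λ p q → δ i p * X p q) ≡ sum (X i)
  ∑²-δ i X = trans (sum-cong-≗ λ p → sym (*-distribˡ-sum (δ i p) (X p))) (∑-δ i (sum ∘ X))

  ∑²-expand : ∀ (i j : Fin n) (s t : Fin n → ℚ) (G : Fin n → Fin n → ℚ) →
    ∑² (λ p q → (δ i p + s p) * (δ j q + t q) * G p q)
    ≡ G i j + ∑[ q < n ] (t q * G i q) + ∑[ p < n ] (s p * G p j) + ∑² (λ p q → s p * t q * G p q)
  ∑²-expand i j s t G = begin
    ∑² (λ p q → (δ i p + s p) * (δ j q + t q) * G p q)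
      ≡⟨ ∑²-cong (λ p q → solve 5 (λ d s e t g → (d :+ s) :* (e :+ t) :* g
                                    := d :* (e :* g) :+ d :* (t :* g) :+ e :* (s :* g) :+ s :* t :* g)
                                 refl (δ i p) (s p) (δ j q) (t q) (G p q)) ⟩
    ∑² (λ p q → g₁ p q + g₂ p q + g₃ p q + g₄ p q)
      ≡⟨ ∑²-distrib-+₄ g₁ g₂ g₃ g₄ ⟩
    ∑² g₁ + ∑² g₂ + ∑² g₃ + ∑² g₄
      ≡⟨ cong₂ (λ u v → u + v + ∑² g₃ + ∑² g₄) (trans (∑²-δ i (λ p q → δ j q * G p q)) (∑-δ j (G i)))
                                                (∑²-δ i (λ p q → t q * G p q)) ⟩
    G i j + ∑[ q < n ] (t q * G i q) + ∑² g₃ + ∑² g₄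
      ≡⟨ cong (λ u → G i j + ∑[ q < n ] (t q * G i q) + u + ∑² g₄) (sum-cong-≗ λ p → ∑-δ j (λ q → s p * G p q)) ⟩
    G i j + ∑[ q < n ] (t q * G i q) + ∑[ p < n ] (s p * G p j) + ∑² g₄ ∎
    where
    open ≡-Reasoning
    g₁ g₂ g₃ g₄ : Fin n → Fin n → ℚ
    g₁ p q = δ i p * (δ j q * G p q)
    g₂ p q = δ i p * (t q * G p q)
    g₃ p q = δ j q * (s p * G p q)
    g₄ p q = s p * t q * G p q

-- Γ₂ on regular graphs

∑ₗ : {A : Set} → List A → (A → ℚ) → ℚ
∑ₗ xs h = sumℚ (map h xs)

infixl 10 ∑ₗ
syntax ∑ₗ xs (λ y → e) = ∑[ y ∈ xs ] e

module _ {A : Set} where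

  ∑ₗ-cong : ∀ xs {g h : A → ℚ} → (∀ y → g y ≡ h y) → ∑ₗ xs g ≡ ∑ₗ xs h
  ∑ₗ-cong []       g≡h = refl
  ∑ₗ-cong (y ∷ xs) g≡h = cong₂ _+_ (g≡h y) (∑ₗ-cong xs g≡h)

  ∑ₗ-distrib-sub : ∀ xs (g h : A → ℚ) → ∑[ y ∈ xs ] (g y - h y) ≡ ∑ₗ xs g - ∑ₗ xs h
  ∑ₗ-distrib-sub []       g h = refl
  ∑ₗ-distrib-sub (y ∷ xs) g h = trans (cong ((g y - h y) +_) (∑ₗ-distrib-sub xs g h))
    (solve 4 (λ a b c d → (a :- b) :+ (c :- d) := (a :+ c) :- (b :+ d)) refl (g y) (h y) (∑ₗ xs g) (∑ₗ xs h))

  *-distribˡ-∑ₗ : ∀ xs c (g : A → ℚ) → c * ∑ₗ xs g ≡ ∑[ y ∈ xs ] (c * g y)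
  *-distribˡ-∑ₗ []       c g = ℚ.*-zeroʳ c
  *-distribˡ-∑ₗ (y ∷ xs) c g = trans (ℚ.*-distribˡ-+ c (g y) (∑ₗ xs g)) (cong (c * g y +_) (*-distribˡ-∑ₗ xs c g))

  ∑ₗ-affine : ∀ xs (g h : A → ℚ) c e →
    ∑[ y ∈ xs ] (g y + c * h y + e) ≡ ∑ₗ xs g + c * ∑ₗ xs h + e * ∑[ _ ∈ xs ] 1ℚ
  ∑ₗ-affine []       g h c e = solve 2 (λ c e → con 0ℚ := con 0ℚ :+ c :* con 0ℚ :+ e :* con 0ℚ) refl c e
  ∑ₗ-affine (y ∷ xs) g h c e = trans (cong ((g y + c * h y + e) +_) (∑ₗ-affine xs g h c e))
    (solve 7 (λ c e gy hy G H N → (gy :+ c :* hy :+ e) :+ (G :+ c :* H :+ e :* N)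
                                   := (gy :+ G) :+ c :* (hy :+ H) :+ e :* (con 1ℚ :+ N))
           refl c e (g y) (h y) (∑ₗ xs g) (∑ₗ xs h) (∑[ _ ∈ xs ] 1ℚ))

  ∑ₗ-++ : ∀ xs ys (h : A → ℚ) → ∑ₗ (xs ++ ys) h ≡ ∑ₗ xs h + ∑ₗ ys h
  ∑ₗ-++ []       ys h = sym (ℚ.+-identityˡ _)
  ∑ₗ-++ (x ∷ xs) ys h = trans (cong (h x +_) (∑ₗ-++ xs ys h)) (sym (ℚ.+-assoc (h x) _ _))

  ∑ₗ-map : ∀ {B : Set} xs (g : B → A) (h : A → ℚ) → ∑ₗ (map g xs) h ≡ ∑ₗ xs (h ∘ g)
  ∑ₗ-map []       g h = refl
  ∑ₗ-map (x ∷ xs) g h = cong (h (g x) +_) (∑ₗ-map xs g h)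

module RegularGraph (G : Graph) (d : ℚ) (regular : ∀ x → ∑[ _ ∈ Graph.nbrs G x ] 1ℚ ≡ d) where
  open Graph G

  four-Γ₂ : ∀ f x → 4ℚ * Γ₂ G f x ≡
    ∑[ y ∈ nbrs x ] ∑[ z ∈ nbrs y ] ((f z - 2ℚ * f y + f x) ²) - ∑[ y ∈ nbrs x ] ∑[ y′ ∈ nbrs x ] ((f y - f y′) ²)
  four-Γ₂ f x = sym (begin
    ∑ₗ (nbrs x) A - ∑ₗ (nbrs x) B
      ≡⟨ ∑ₗ-distrib-sub (nbrs x) A B ⟨
    ∑[ y ∈ nbrs x ] (A y - B y)
      ≡⟨ ∑ₗ-cong (nbrs x) A-B ⟩
    ∑[ y ∈ nbrs x ] (2ℚ * (Γ G f y - Γ G f x) - 2ℚ * ((f x - f y) * (Δ G f x - Δ G f y)))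
      ≡⟨ ∑ₗ-distrib-sub (nbrs x) _ _ ⟩
    ∑[ y ∈ nbrs x ] (2ℚ * (Γ G f y - Γ G f x)) - ∑[ y ∈ nbrs x ] (2ℚ * ((f x - f y) * (Δ G f x - Δ G f y)))
      ≡⟨ cong₂ _-_ (*-distribˡ-∑ₗ (nbrs x) 2ℚ _) (*-distribˡ-∑ₗ (nbrs x) 2ℚ _) ⟨
    2ℚ * Δ G (Γ G f) x - 2ℚ * ∑[ y ∈ nbrs x ] ((f x - f y) * (Δ G f x - Δ G f y))
      ≡⟨ solve 2 (λ D E → con 2ℚ :* D :- con 2ℚ :* E := con 4ℚ :* (con ½ :* D :- con ½ :* E)) refl
           (Δ G (Γ G f) x) (∑[ y ∈ nbrs x ] ((f x - f y) * (Δ G f x - Δ G f y))) ⟩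
    4ℚ * Γ₂ G f x ∎)
    where
    open ≡-Reasoning
    A B : V → ℚ
    A y = ∑[ z ∈ nbrs y ] ((f z - 2ℚ * f y + f x) ²)
    B y = ∑[ y′ ∈ nbrs x ] ((f y - f y′) ²)

    A≡ : ∀ y → A y ≡ ∑[ z ∈ nbrs y ] ((f y - f z) ²) + (- 2ℚ * (f y - f x)) * Δ G f y + (f y - f x) ² * d
    A≡ y = begin
      A y
        ≡⟨ ∑ₗ-cong (nbrs y) (λ z → solve 3 (λ fx fy fz →
             (fz :- con 2ℚ :* fy :+ fx) :* (fz :- con 2ℚ :* fy :+ fx)
             := (fy :- fz) :* (fy :- fz) :+ (:- con 2ℚ :* (fy :- fx)) :* (fz :- fy) :+ (fy :- fx) :* (fy :- fx))
             refl (f x) (f y) (f z)) ⟩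
      ∑[ z ∈ nbrs y ] ((f y - f z) ² + (- 2ℚ * (f y - f x)) * (f z - f y) + (f y - f x) ²)
        ≡⟨ ∑ₗ-affine (nbrs y) (λ z → (f y - f z) ²) (λ z → f z - f y) (- 2ℚ * (f y - f x)) ((f y - f x) ²) ⟩
      ∑[ z ∈ nbrs y ] ((f y - f z) ²) + (- 2ℚ * (f y - f x)) * Δ G f y + (f y - f x) ² * ∑[ _ ∈ nbrs y ] 1ℚ
        ≡⟨ cong (λ e → ∑[ z ∈ nbrs y ] ((f y - f z) ²) + (- 2ℚ * (f y - f x)) * Δ G f y + (f y - f x) ² * e) (regular y) ⟩
      ∑[ z ∈ nbrs y ] ((f y - f z) ²) + (- 2ℚ * (f y - f x)) * Δ G f y + (f y - f x) ² * d ∎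

    B≡ : ∀ y → B y ≡ ∑[ z ∈ nbrs x ] ((f x - f z) ²) + (- 2ℚ * (f y - f x)) * Δ G f x + (f y - f x) ² * d
    B≡ y = begin
      B y
        ≡⟨ ∑ₗ-cong (nbrs x) (λ z → solve 3 (λ fx fy fz →
             (fy :- fz) :* (fy :- fz)
             := (fx :- fz) :* (fx :- fz) :+ (:- con 2ℚ :* (fy :- fx)) :* (fz :- fx) :+ (fy :- fx) :* (fy :- fx))
             refl (f x) (f y) (f z)) ⟩
      ∑[ z ∈ nbrs x ] ((f x - f z) ² + (- 2ℚ * (f y - f x)) * (f z - f x) + (f y - f x) ²)
        ≡⟨ ∑ₗ-affine (nbrs x) (λ z → (f x - f z) ²) (λ z → f z - f x) (- 2ℚ * (f y - f x)) ((f y - f x) ²) ⟩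
      ∑[ z ∈ nbrs x ] ((f x - f z) ²) + (- 2ℚ * (f y - f x)) * Δ G f x + (f y - f x) ² * ∑[ _ ∈ nbrs x ] 1ℚ
        ≡⟨ cong (λ e → ∑[ z ∈ nbrs x ] ((f x - f z) ²) + (- 2ℚ * (f y - f x)) * Δ G f x + (f y - f x) ² * e) (regular x) ⟩
      ∑[ z ∈ nbrs x ] ((f x - f z) ²) + (- 2ℚ * (f y - f x)) * Δ G f x + (f y - f x) ² * d ∎

    -- The two d-terms cancel; this is where regularity is used.
    A-B : ∀ y → A y - B y ≡ 2ℚ * (Γ G f y - Γ G f x) - 2ℚ * ((f x - f y) * (Δ G f x - Δ G f y))
    A-B y = trans (cong₂ _-_ (A≡ y) (B≡ y))
      (solve 7 (λ Sy Sx Dy Dx fy fx d →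
          (Sy :+ (:- con 2ℚ :* (fy :- fx)) :* Dy :+ (fy :- fx) :* (fy :- fx) :* d)
            :- (Sx :+ (:- con 2ℚ :* (fy :- fx)) :* Dx :+ (fy :- fx) :* (fy :- fx) :* d)
          := con 2ℚ :* (con ½ :* Sy :- con ½ :* Sx) :- con 2ℚ :* ((fx :- fy) :* (Dx :- Dy)))
        refl (∑[ z ∈ nbrs y ] ((f y - f z) ²)) (∑[ z ∈ nbrs x ] ((f x - f z) ²)) (Δ G f y) (Δ G f x) (f y) (f x) d)

-- Swapping coordinates of Boolean vectors

bit : Bool → ℕ
bit b = if b then 1 else 0

weight-update : ∀ {n} (x : Vec Bool n) i b → bit (lookup x i) ℕ.+ weight (x [ i ]≔ b) ≡ bit b ℕ.+ weight x
weight-update (c ∷ x) zero    b = x∙yz≈y∙xz (bit c) (bit b) (weight x)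
weight-update (c ∷ x) (suc i) b = begin
  bit (lookup x i) ℕ.+ (bit c ℕ.+ weight (x [ i ]≔ b)) ≡⟨ x∙yz≈y∙xz (bit (lookup x i)) (bit c) _ ⟩
  bit c ℕ.+ (bit (lookup x i) ℕ.+ weight (x [ i ]≔ b)) ≡⟨ cong (bit c ℕ.+_) (weight-update x i b) ⟩
  bit c ℕ.+ (bit b ℕ.+ weight x)                       ≡⟨ x∙yz≈y∙xz (bit c) (bit b) (weight x) ⟩
  bit b ℕ.+ (bit c ℕ.+ weight x)                       ∎
  where open ≡-Reasoning

module _ {n : ℕ} where

  ≢-by-value : ∀ (x : Vec Bool n) {i j} → lookup x i ≡ true → lookup x j ≡ false → i ≢ j
  ≢-by-value x xi≡true xj≡false refl with trans (sym xi≡true) xj≡false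
  ... | ()

  swap : Fin n → Fin n → Vec Bool n → Vec Bool n
  swap p q x = (x [ p ]≔ lookup x q) [ q ]≔ lookup x p

  lookup-swapˡ : ∀ x p q → lookup (swap p q x) p ≡ lookup x q
  lookup-swapˡ x p q with p ≟ q
  ... | yes refl = lookup∘update p (x [ p ]≔ lookup x p) (lookup x p)
  ... | no p≢q   = trans (lookup∘update′ p≢q (x [ p ]≔ lookup x q) (lookup x p)) (lookup∘update p x (lookup x q))

  lookup-swapʳ : ∀ x p q → lookup (swap p q x) q ≡ lookup x p
  lookup-swapʳ x p q = lookup∘update q (x [ p ]≔ lookup x q) (lookup x p)

  lookup-swap-other : ∀ x {p q r} → r ≢ p → r ≢ q → lookup (swap p q x) r ≡ lookup x r
  lookup-swap-other x {p} {q} r≢p r≢q =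
    trans (lookup∘update′ r≢q (x [ p ]≔ lookup x q) (lookup x p)) (lookup∘update′ r≢p x (lookup x q))

  weight-swap : ∀ x p q → weight (swap p q x) ≡ weight x
  weight-swap x p q = ℕₚ.+-cancelˡ-≡ (bit (lookup x q)) _ _ (begin
    bit (lookup x q) ℕ.+ weight (swap p q x)   ≡⟨ cong (λ b → bit b ℕ.+ weight (swap p q x)) lookup-y-q ⟨
    bit (lookup y q) ℕ.+ weight (swap p q x)   ≡⟨ weight-update y q (lookup x p) ⟩
    bit (lookup x p) ℕ.+ weight y              ≡⟨ weight-update x p (lookup x q) ⟩
    bit (lookup x q) ℕ.+ weight x              ∎)
    where
    open ≡-Reasoning
    y : Vec Bool n
    y = x [ p ]≔ lookup x q
    lookup-y-q : lookup y q ≡ lookup x q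
    lookup-y-q with q ≟ p
    ... | yes refl = lookup∘update q x (lookup x q)
    ... | no q≢p   = lookup∘update′ q≢p x (lookup x q)

  swap-involutive : ∀ x p q → swap q p (swap p q x) ≡ x
  swap-involutive x p q = Pointwise-≡⇒≡ (ext at)
    where
    at : ∀ r → lookup (swap q p (swap p q x)) r ≡ lookup x r
    at r with r ≟ p | r ≟ q
    ... | yes refl | _        = trans (lookup-swapʳ (swap r q x) q r) (lookup-swapʳ x r q)
    ... | no _     | yes refl = trans (lookup-swapˡ (swap p r x) r p) (lookup-swapˡ x p r)
    ... | no r≢p   | no r≢q   = trans (lookup-swap-other (swap p q x) r≢q r≢p) (lookup-swap-other x r≢p r≢q)

  swap-comm : ∀ x p q → swap p q x ≡ swap q p x
  swap-comm x p q = Pointwise-≡⇒≡ (ext at)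
    where
    at : ∀ r → lookup (swap p q x) r ≡ lookup (swap q p x) r
    at r with r ≟ p | r ≟ q
    ... | yes refl | _        = trans (lookup-swapˡ x r q) (sym (lookup-swapʳ x q r))
    ... | no _     | yes refl = trans (lookup-swapʳ x p r) (sym (lookup-swapˡ x r p))
    ... | no r≢p   | no r≢q   = trans (lookup-swap-other x r≢p r≢q) (sym (lookup-swap-other x r≢q r≢p))

  swap-swap-merge : ∀ x {a b c} → lookup x a ≡ lookup x b → c ≢ a → c ≢ b → a ≢ b →
                    swap a b (swap c a x) ≡ swap c b x
  swap-swap-merge x {a} {b} {c} xa≡xb c≢a c≢b a≢b = Pointwise-≡⇒≡ (ext at)
    where
    y : Vec Bool n
    y = swap c a x
    at : ∀ r → lookup (swap a b y) r ≡ lookup (swap c b x) r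
    at r with r ≟ c | r ≟ a | r ≟ b
    ... | yes refl | _        | _        = begin
      lookup (swap a b y) r ≡⟨ lookup-swap-other y c≢a c≢b ⟩
      lookup y r            ≡⟨ lookup-swapˡ x r a ⟩
      lookup x a            ≡⟨ xa≡xb ⟩
      lookup x b            ≡⟨ lookup-swapˡ x r b ⟨
      lookup (swap r b x) r ∎
      where open ≡-Reasoning
    ... | no r≢c   | yes refl | _        = begin
      lookup (swap r b y) r ≡⟨ lookup-swapˡ y r b ⟩
      lookup y b            ≡⟨ lookup-swap-other x (c≢b ∘ sym) (a≢b ∘ sym) ⟩
      lookup x b            ≡⟨ xa≡xb ⟨
      lookup x r            ≡⟨ lookup-swap-other x r≢c a≢b ⟨
      lookup (swap c b x) r ∎
      where open ≡-Reasoning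
    ... | no _     | no _     | yes refl =
      trans (lookup-swapʳ y a r) (trans (lookup-swapʳ x c a) (sym (lookup-swapʳ x c r)))
    ... | no r≢c   | no r≢a   | no r≢b   =
      trans (lookup-swap-other y r≢a r≢b) (trans (lookup-swap-other x r≢c r≢a) (sym (lookup-swap-other x r≢c r≢b)))

  record DisjointSwaps (x : Vec Bool n) (p q p′ q′ : Fin n) : Set where
    field
      p∈x  : lookup x p ≡ true
      q∉x  : lookup x q ≡ false
      p′∈x : lookup x p′ ≡ true
      q′∉x : lookup x q′ ≡ false
      p≢p′ : p ≢ p′
      q≢q′ : q ≢ q′

  exchange-ones : ∀ {x p q p′ q′} → DisjointSwaps x p q p′ q′ → DisjointSwaps x p′ q p q′
  exchange-ones d = record
    { p∈x = p′∈x ; q∉x = q∉x ; p′∈x = p∈x ; q′∉x = q′∉x ; p≢p′ = p≢p′ ∘ sym ; q≢q′ = q≢q′ }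
    where open DisjointSwaps d

  exchange-zeros : ∀ {x p q p′ q′} → DisjointSwaps x p q p′ q′ → DisjointSwaps x p q′ p′ q
  exchange-zeros d = record
    { p∈x = p∈x ; q∉x = q′∉x ; p′∈x = p′∈x ; q′∉x = q∉x ; p≢p′ = p≢p′ ; q≢q′ = q≢q′ ∘ sym }
    where open DisjointSwaps d

  module LookupSwap₂ {x : Vec Bool n} {p q p′ q′ : Fin n} (d : DisjointSwaps x p q p′ q′) where
    open DisjointSwaps d

    p≢q : p ≢ q
    p≢q = ≢-by-value x p∈x q∉x
    p≢q′ : p ≢ q′
    p≢q′ = ≢-by-value x p∈x q′∉x
    p′≢q : p′ ≢ q
    p′≢q = ≢-by-value x p′∈x q∉x
    p′≢q′ : p′ ≢ q′
    p′≢q′ = ≢-by-value x p′∈x q′∉x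
    y : Vec Bool n
    y = swap p q x

    at-p : lookup (swap p′ q′ y) p ≡ false
    at-p = trans (lookup-swap-other y p≢p′ p≢q′) (trans (lookup-swapˡ x p q) q∉x)

    at-q : lookup (swap p′ q′ y) q ≡ true
    at-q = trans (lookup-swap-other y (p′≢q ∘ sym) q≢q′) (trans (lookup-swapʳ x p q) p∈x)

    at-p′ : lookup (swap p′ q′ y) p′ ≡ false
    at-p′ = trans (lookup-swapˡ y p′ q′) (trans (lookup-swap-other x (p≢q′ ∘ sym) (q≢q′ ∘ sym)) q′∉x)

    at-q′ : lookup (swap p′ q′ y) q′ ≡ true
    at-q′ = trans (lookup-swapʳ y p′ q′) (trans (lookup-swap-other x (p≢p′ ∘ sym) p′≢q) p′∈x)

    at-other : ∀ {r} → r ≢ p → r ≢ q → r ≢ p′ → r ≢ q′ → lookup (swap p′ q′ y) r ≡ lookup x r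
    at-other r≢p r≢q r≢p′ r≢q′ = trans (lookup-swap-other y r≢p′ r≢q′) (lookup-swap-other x r≢p r≢q)

  swap₂-exchange-ones : ∀ {x p q p′ q′} → DisjointSwaps x p q p′ q′ →
                        swap p q′ (swap p′ q x) ≡ swap p′ q′ (swap p q x)
  swap₂-exchange-ones {x} {p} {q} {p′} {q′} d = Pointwise-≡⇒≡ (ext at)
    where
    module Z = LookupSwap₂ d
    module Z′ = LookupSwap₂ (exchange-ones d)
    at : ∀ r → lookup (swap p q′ (swap p′ q x)) r ≡ lookup (swap p′ q′ (swap p q x)) r
    at r with r ≟ p | r ≟ q | r ≟ p′ | r ≟ q′
    ... | yes refl | _        | _        | _        = trans Z′.at-p′ (sym Z.at-p)
    ... | no _     | yes refl | _        | _        = trans Z′.at-q (sym Z.at-q)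
    ... | no _     | no _     | yes refl | _        = trans Z′.at-p (sym Z.at-p′)
    ... | no _     | no _     | no _     | yes refl = trans Z′.at-q′ (sym Z.at-q′)
    ... | no r≢p   | no r≢q   | no r≢p′  | no r≢q′  =
      trans (Z′.at-other r≢p′ r≢q r≢p r≢q′) (sym (Z.at-other r≢p r≢q r≢p′ r≢q′))

  swap₂-exchange-zeros : ∀ {x p q p′ q′} → DisjointSwaps x p q p′ q′ →
                         swap p′ q (swap p q′ x) ≡ swap p′ q′ (swap p q x)
  swap₂-exchange-zeros {x} {p} {q} {p′} {q′} d = Pointwise-≡⇒≡ (ext at)
    where
    module Z = LookupSwap₂ d
    module Z′ = LookupSwap₂ (exchange-zeros d)
    at : ∀ r → lookup (swap p′ q (swap p q′ x)) r ≡ lookup (swap p′ q′ (swap p q x)) r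
    at r with r ≟ p | r ≟ q | r ≟ p′ | r ≟ q′
    ... | yes refl | _        | _        | _        = trans Z′.at-p (sym Z.at-p)
    ... | no _     | yes refl | _        | _        = trans Z′.at-q′ (sym Z.at-q)
    ... | no _     | no _     | yes refl | _        = trans Z′.at-p′ (sym Z.at-p′)
    ... | no _     | no _     | no _     | yes refl = trans Z′.at-q (sym Z.at-q′)
    ... | no r≢p   | no r≢q   | no r≢p′  | no r≢q′  =
      trans (Z′.at-other r≢p r≢q′ r≢p′ r≢q) (sym (Z.at-other r≢p r≢q r≢p′ r≢q′))

  ⟦lookup-swap⟧ : ∀ x {p q} → lookup x p ≡ true → lookup x q ≡ false → ∀ r →
                  ⟦ lookup (swap p q x) r ⟧ ≡ δ q r + ⟦ lookup x r ⟧ * δᶜ p r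
  ⟦lookup-swap⟧ x {p} {q} xp xq r with r ≟ p | r ≟ q
  ... | yes refl | _ rewrite lookup-swapˡ x p q | xq | xp
                           | dec-false (q ≟ p) (≢-by-value x xp xq ∘ sym) | dec-true (p ≟ p) refl = refl
  ... | no _ | yes refl rewrite lookup-swapʳ x p q | xq | xp
                              | dec-true (q ≟ q) refl | dec-false (p ≟ q) (≢-by-value x xp xq) = refl
  ... | no r≢p | no r≢q rewrite lookup-swap-other x r≢p r≢q
                              | dec-false (q ≟ r) (r≢q ∘ sym) | dec-false (p ≟ r) (r≢p ∘ sym) =
    sym (trans (ℚ.+-identityˡ _) (ℚ.*-identityʳ _))

  ⟦not-lookup-swap⟧ : ∀ x {p q} → lookup x p ≡ true → lookup x q ≡ false → ∀ r →
                      ⟦ not (lookup (swap p q x) r) ⟧ ≡ δ p r + ⟦ not (lookup x r) ⟧ * δᶜ q r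
  ⟦not-lookup-swap⟧ x {p} {q} xp xq r with r ≟ p | r ≟ q
  ... | yes refl | _ rewrite lookup-swapˡ x p q | xq | xp
                           | dec-true (p ≟ p) refl | dec-false (q ≟ p) (≢-by-value x xp xq ∘ sym) = refl
  ... | no _ | yes refl rewrite lookup-swapʳ x p q | xq | xp
                              | dec-false (p ≟ q) (≢-by-value x xp xq) | dec-true (q ≟ q) refl = refl
  ... | no r≢p | no r≢q rewrite lookup-swap-other x r≢p r≢q
                              | dec-false (p ≟ r) (r≢p ∘ sym) | dec-false (q ≟ r) (r≢q ∘ sym) =
    sym (trans (ℚ.+-identityˡ _) (ℚ.*-identityʳ _))

module _ {n : ℕ} where

  hamming : Vec Bool n → Vec Bool n → ℚ
  hamming x y = ∑[ r < n ] ⟦ lookup x r xor lookup y r ⟧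

  hamming-self : ∀ x → hamming x x ≡ 0ℚ
  hamming-self x = ∑-zero λ r → cong ⟦_⟧ (xor-same (lookup x r))

  hamming-swap : ∀ x {p q} → lookup x p ≡ true → lookup x q ≡ false → hamming x (swap p q x) ≡ 2ℚ
  hamming-swap x {p} {q} xp xq = begin
    hamming x (swap p q x)                 ≡⟨ sum-cong-≗ at ⟩
    ∑[ r < n ] (δ p r + δ q r)             ≡⟨ ∑-distrib-+ (δ p) (δ q) ⟩
    ∑[ r < n ] δ p r + ∑[ r < n ] δ q r    ≡⟨ cong₂ _+_ (∑-δ₁ p) (∑-δ₁ q) ⟩
    2ℚ                                     ∎
    where
    open ≡-Reasoning
    p≢q : p ≢ q
    p≢q = ≢-by-value x xp xq
    at : ∀ r → ⟦ lookup x r xor lookup (swap p q x) r ⟧ ≡ δ p r + δ q r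
    at r with r ≟ p | r ≟ q
    ... | yes refl | _ rewrite lookup-swapˡ x p q | xp | xq | dec-true (p ≟ p) refl | dec-false (q ≟ p) (p≢q ∘ sym) = refl
    ... | no _ | yes refl rewrite lookup-swapʳ x p q | xp | xq | dec-false (p ≟ q) p≢q | dec-true (q ≟ q) refl = refl
    ... | no r≢p | no r≢q rewrite lookup-swap-other x r≢p r≢q | xor-same (lookup x r)
                                | dec-false (p ≟ r) (r≢p ∘ sym) | dec-false (q ≟ r) (r≢q ∘ sym) = refl

  hamming-swap₂ : ∀ {x p q p′ q′} → DisjointSwaps x p q p′ q′ → hamming x (swap p′ q′ (swap p q x)) ≡ 4ℚ
  hamming-swap₂ {x} {p} {q} {p′} {q′} d = begin
    hamming x (swap p′ q′ (swap p q x))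
      ≡⟨ sum-cong-≗ at ⟩
    ∑[ r < n ] (δ p r + δ q r + δ p′ r + δ q′ r)
      ≡⟨ trans (∑-distrib-+ _ (δ q′)) (cong (_+ sum (δ q′))
           (trans (∑-distrib-+ _ (δ p′)) (cong (_+ sum (δ p′)) (∑-distrib-+ (δ p) (δ q))))) ⟩
    sum (δ p) + sum (δ q) + sum (δ p′) + sum (δ q′)
      ≡⟨ cong₂ _+_ (cong₂ _+_ (cong₂ _+_ (∑-δ₁ p) (∑-δ₁ q)) (∑-δ₁ p′)) (∑-δ₁ q′) ⟩
    4ℚ ∎
    where
    open ≡-Reasoning
    open DisjointSwaps d
    open LookupSwap₂ d
    at : ∀ r → ⟦ lookup x r xor lookup (swap p′ q′ (swap p q x)) r ⟧ ≡ δ p r + δ q r + δ p′ r + δ q′ r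
    at r with r ≟ p | r ≟ q | r ≟ p′ | r ≟ q′
    ... | yes refl | _ | _ | _ rewrite at-p | p∈x | dec-true (p ≟ p) refl | dec-false (q ≟ p) (p≢q ∘ sym)
                                     | dec-false (p′ ≟ p) (p≢p′ ∘ sym) | dec-false (q′ ≟ p) (p≢q′ ∘ sym) = refl
    ... | no _ | yes refl | _ | _ rewrite at-q | q∉x | dec-false (p ≟ q) p≢q | dec-true (q ≟ q) refl
                                        | dec-false (p′ ≟ q) p′≢q | dec-false (q′ ≟ q) (q≢q′ ∘ sym) = refl
    ... | no _ | no _ | yes refl | _ rewrite at-p′ | p′∈x | dec-false (p ≟ p′) p≢p′ | dec-false (q ≟ p′) (p′≢q ∘ sym)
                                           | dec-true (p′ ≟ p′) refl | dec-false (q′ ≟ p′) (p′≢q′ ∘ sym) = refl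
    ... | no _ | no _ | no _ | yes refl rewrite at-q′ | q′∉x | dec-false (p ≟ q′) p≢q′ | dec-false (q ≟ q′) q≢q′
                                              | dec-false (p′ ≟ q′) p′≢q′ | dec-true (q′ ≟ q′) refl = refl
    ... | no r≢p | no r≢q | no r≢p′ | no r≢q′
      rewrite at-other r≢p r≢q r≢p′ r≢q′ | xor-same (lookup x r)
            | dec-false (p ≟ r) (r≢p ∘ sym) | dec-false (q ≟ r) (r≢q ∘ sym)
            | dec-false (p′ ≟ r) (r≢p′ ∘ sym) | dec-false (q′ ≟ r) (r≢q′ ∘ sym) = refl

-- Neighbourhoods in J(n,k)

∑ᵛ : ∀ {n} → (Vec Bool n → ℚ) → ℚ
∑ᵛ {zero}  H = H []
∑ᵛ {suc n} H = ∑ᵛ (H ∘ (true ∷_)) + ∑ᵛ (H ∘ (false ∷_))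

∑ᵛ-zero : ∀ {n} {H : Vec Bool n → ℚ} → (∀ y → H y ≡ 0ℚ) → ∑ᵛ H ≡ 0ℚ
∑ᵛ-zero {zero}  H≡0 = H≡0 []
∑ᵛ-zero {suc n} H≡0 = cong₂ _+_ (∑ᵛ-zero (H≡0 ∘ (true ∷_))) (∑ᵛ-zero (H≡0 ∘ (false ∷_)))

∑ₗ-allVecs : ∀ n (H : Vec Bool n → ℚ) → ∑ₗ (allVecs n) H ≡ ∑ᵛ H
∑ₗ-allVecs zero    H = ℚ.+-identityʳ (H [])
∑ₗ-allVecs (suc n) H = begin
  ∑ₗ (map (true ∷_) (allVecs n) ++ map (false ∷_) (allVecs n)) H
    ≡⟨ ∑ₗ-++ (map (true ∷_) (allVecs n)) _ H ⟩
  ∑ₗ (map (true ∷_) (allVecs n)) H + ∑ₗ (map (false ∷_) (allVecs n)) H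
    ≡⟨ cong₂ _+_ (trans (∑ₗ-map (allVecs n) _ H) (∑ₗ-allVecs n _)) (trans (∑ₗ-map (allVecs n) _ H) (∑ₗ-allVecs n _)) ⟩
  ∑ᵛ (H ∘ (true ∷_)) + ∑ᵛ (H ∘ (false ∷_)) ∎
  where open ≡-Reasoning

module _ {n k : ℕ} where

  extend : (Vertex n k → ℚ) → Vec Bool n → ℚ
  extend F y with weight y ℕ.≟ k
  ... | yes w = F (y , w)
  ... | no _  = 0ℚ

  extend-vertex : ∀ F y (w : weight y ≡ k) → extend F y ≡ F (y , w)
  extend-vertex F y w with weight y ℕ.≟ k
  ... | yes w′ = cong (λ w → F (y , w)) (ℕₚ.≡-irrelevant w′ w)
  ... | no w̸   = contradiction w w̸

m≢2+m : ∀ (m : ℕ) → m ≢ suc (suc m)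
m≢2+m m ()

∑ᵛ-diff₀ : ∀ {n} (x : Vec Bool n) (P : ℕ → Bool) (H : Vec Bool n → ℚ) →
           ∑ᵛ (λ y → ⟦ P (weight y) ⟧ * ⟦ diffCount x y ≡ᵇ 0 ⟧ * H y) ≡ ⟦ P (weight x) ⟧ * H x
∑ᵛ-diff₀ []          P H = cong (_* H []) (ℚ.*-identityʳ ⟦ P 0 ⟧)
∑ᵛ-diff₀ (true ∷ x)  P H = trans (cong₂ _+_ (∑ᵛ-diff₀ x (P ∘ suc) (H ∘ (true ∷_)))
                                             (∑ᵛ-zero λ y → x*0*y≡0 ⟦ P (weight y) ⟧ (H (false ∷ y))))
                                 (ℚ.+-identityʳ _)
∑ᵛ-diff₀ (false ∷ x) P H = trans (cong₂ _+_ (∑ᵛ-zero λ y → x*0*y≡0 ⟦ P (suc (weight y)) ⟧ (H (true ∷ y)))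
                                             (∑ᵛ-diff₀ x P (H ∘ (false ∷_))))
                                 (ℚ.+-identityˡ _)

-- does (m ℕ.≟ n) reduces to m ≡ᵇ n, so dec-true and dec-false evaluate these brackets.
∑ᵛ-diff₀-self : ∀ {n} (x : Vec Bool n) (H : Vec Bool n → ℚ) →
                ∑ᵛ (λ y → ⟦ weight y ≡ᵇ weight x ⟧ * ⟦ diffCount x y ≡ᵇ 0 ⟧ * H y) ≡ H x
∑ᵛ-diff₀-self x H = trans (∑ᵛ-diff₀ x (_≡ᵇ weight x) H)
  (trans (cong (λ b → ⟦ b ⟧ * H x) (dec-true (weight x ℕ.≟ weight x) refl)) (ℚ.*-identityˡ (H x)))

∑ᵛ-diff₀-none : ∀ {n} (x : Vec Bool n) (P : ℕ → Bool) (H : Vec Bool n → ℚ) → P (weight x) ≡ false →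
                ∑ᵛ (λ y → ⟦ P (weight y) ⟧ * ⟦ diffCount x y ≡ᵇ 0 ⟧ * H y) ≡ 0ℚ
∑ᵛ-diff₀-none x P H Px≡false = trans (∑ᵛ-diff₀ x P H) (trans (cong (λ b → ⟦ b ⟧ * H x) Px≡false) (ℚ.*-zeroˡ (H x)))

∑ᵛ-add : ∀ {n} (x : Vec Bool n) (H : Vec Bool n → ℚ) →
         ∑ᵛ (λ y → ⟦ weight y ≡ᵇ suc (weight x) ⟧ * ⟦ diffCount x y ≡ᵇ 1 ⟧ * H y)
         ≡ ∑[ i < n ] (⟦ not (lookup x i) ⟧ * H (x [ i ]≔ true))
∑ᵛ-add []          H = ℚ.*-zeroˡ (H [])
∑ᵛ-add (true ∷ x)  H =
  trans (+-identityʳ′ _ (∑ᵛ-diff₀-none x (_≡ᵇ suc (suc (weight x))) (H ∘ (false ∷_))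
                                        (dec-false (weight x ℕ.≟ _) (m≢2+m (weight x)))))
        (trans (∑ᵛ-add x (H ∘ (true ∷_))) (sym (+-identityˡ′ _ (ℚ.*-zeroˡ (H (true ∷ x))))))
∑ᵛ-add (false ∷ x) H =
  cong₂ _+_ (trans (∑ᵛ-diff₀-self x (H ∘ (true ∷_))) (sym (ℚ.*-identityˡ _))) (∑ᵛ-add x (H ∘ (false ∷_)))

∑ᵛ-remove : ∀ {n} (x : Vec Bool n) (H : Vec Bool n → ℚ) →
            ∑ᵛ (λ y → ⟦ suc (weight y) ≡ᵇ weight x ⟧ * ⟦ diffCount x y ≡ᵇ 1 ⟧ * H y)
            ≡ ∑[ i < n ] (⟦ lookup x i ⟧ * H (x [ i ]≔ false))
∑ᵛ-remove []          H = ℚ.*-zeroˡ (H [])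
∑ᵛ-remove {suc n} (true ∷ x) H = begin
  _                        ≡⟨ cong₂ _+_ (∑ᵛ-remove x (H ∘ (true ∷_))) (∑ᵛ-diff₀-self x (H ∘ (false ∷_))) ⟩
  R + H (false ∷ x)        ≡⟨ ℚ.+-comm R (H (false ∷ x)) ⟩
  H (false ∷ x) + R        ≡⟨ cong (_+ R) (ℚ.*-identityˡ (H (false ∷ x))) ⟨
  1ℚ * H (false ∷ x) + R   ∎
  where
  open ≡-Reasoning
  R : ℚ
  R = ∑[ i < n ] (⟦ lookup x i ⟧ * H (true ∷ x [ i ]≔ false))
∑ᵛ-remove (false ∷ x) H =
  trans (+-identityˡ′ _ (∑ᵛ-diff₀-none x (λ m → suc (suc m) ≡ᵇ weight x) (H ∘ (true ∷_))
                                        (dec-false (_ ℕ.≟ weight x) (m≢2+m (weight x) ∘ sym))))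
        (trans (∑ᵛ-remove x (H ∘ (false ∷_))) (sym (+-identityˡ′ _ (ℚ.*-zeroˡ (H (false ∷ x))))))

∑ᵛ-swap : ∀ {n} (x : Vec Bool n) (H : Vec Bool n → ℚ) →
          ∑ᵛ (λ y → ⟦ weight y ≡ᵇ weight x ⟧ * ⟦ diffCount x y ≡ᵇ 2 ⟧ * H y)
          ≡ ∑² (λ p q → ⟦ lookup x p ⟧ * ⟦ not (lookup x q) ⟧ * H (swap p q x))
∑ᵛ-swap []          H = ℚ.*-zeroˡ (H [])
∑ᵛ-swap {suc n} (true ∷ x) H = sym (begin
  ∑² g                ≡⟨ ∑²-suc g ⟩
  g zero zero + ∑[ q < n ] g zero (suc q) + ∑[ p < n ] g (suc p) zero + I
    ≡⟨ cong₂ (λ a b → a + b + ∑[ p < n ] g (suc p) zero + I) (x*0*y≡0 1ℚ (H (true ∷ x))) (sum-cong-≗ added) ⟩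
  0ℚ + A + ∑[ p < n ] g (suc p) zero + I
    ≡⟨ cong (λ c → 0ℚ + A + c + I) (∑-zero λ p → x*0*y≡0 ⟦ lookup x p ⟧ (H (swap (suc p) zero (true ∷ x)))) ⟩
  0ℚ + A + 0ℚ + I     ≡⟨ solve 2 (λ A I → con 0ℚ :+ A :+ con 0ℚ :+ I := I :+ A) refl A I ⟩
  I + A               ≡⟨ cong₂ _+_ (∑ᵛ-swap x (H ∘ (true ∷_))) (∑ᵛ-add x (H ∘ (false ∷_))) ⟨
  _                   ∎)
  where
  open ≡-Reasoning
  g : Fin (suc n) → Fin (suc n) → ℚ
  g p q = ⟦ lookup (true ∷ x) p ⟧ * ⟦ not (lookup (true ∷ x) q) ⟧ * H (swap p q (true ∷ x))
  I A : ℚ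
  I = ∑² (λ p q → g (suc p) (suc q))
  A = ∑[ i < n ] (⟦ not (lookup x i) ⟧ * H (false ∷ x [ i ]≔ true))
  added : ∀ i → g zero (suc i) ≡ ⟦ not (lookup x i) ⟧ * H (false ∷ x [ i ]≔ true)
  added i = trans (cong (_* H (swap zero (suc i) (true ∷ x))) (ℚ.*-identityˡ ⟦ not (lookup x i) ⟧))
    (⟦⟧*-cong (not (lookup x i)) λ xi → cong (λ b → H (b ∷ x [ i ]≔ true)) (not≡true⇒≡false xi))
∑ᵛ-swap {suc n} (false ∷ x) H = sym (begin
  ∑² g                ≡⟨ ∑²-suc g ⟩
  g zero zero + ∑[ q < n ] g zero (suc q) + ∑[ p < n ] g (suc p) zero + I
    ≡⟨ cong₂ (λ a b → a + b + ∑[ p < n ] g (suc p) zero + I) (ℚ.*-zeroˡ (H (false ∷ x)))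
             (∑-zero λ q → 0*x*y≡0 ⟦ not (lookup x q) ⟧ (H (swap zero (suc q) (false ∷ x)))) ⟩
  0ℚ + 0ℚ + ∑[ p < n ] g (suc p) zero + I
    ≡⟨ cong (λ c → 0ℚ + 0ℚ + c + I) (sum-cong-≗ removed) ⟩
  0ℚ + 0ℚ + R + I     ≡⟨ solve 2 (λ R I → con 0ℚ :+ con 0ℚ :+ R :+ I := R :+ I) refl R I ⟩
  R + I               ≡⟨ cong₂ _+_ (∑ᵛ-remove x (H ∘ (true ∷_))) (∑ᵛ-swap x (H ∘ (false ∷_))) ⟨
  _                   ∎)
  where
  open ≡-Reasoning
  g : Fin (suc n) → Fin (suc n) → ℚ
  g p q = ⟦ lookup (false ∷ x) p ⟧ * ⟦ not (lookup (false ∷ x) q) ⟧ * H (swap p q (false ∷ x))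
  I R : ℚ
  I = ∑² (λ p q → g (suc p) (suc q))
  R = ∑[ i < n ] (⟦ lookup x i ⟧ * H (true ∷ x [ i ]≔ false))
  removed : ∀ i → g (suc i) zero ≡ ⟦ lookup x i ⟧ * H (true ∷ x [ i ]≔ false)
  removed i = trans (cong (_* H (swap (suc i) zero (false ∷ x))) (ℚ.*-identityʳ ⟦ lookup x i ⟧))
    (⟦⟧*-cong (lookup x i) λ xi → cong (λ b → H (b ∷ x [ i ]≔ false)) xi)

module _ {n k : ℕ} where

  swapᵛ : Fin n → Fin n → Vertex n k → Vertex n k
  swapᵛ p q (x , w) = swap p q x , trans (weight-swap x p q) w

  ∑-selectNbrs : ∀ (F : Vertex n k → ℚ) x ys →
    ∑ₗ (selectNbrs k x ys) F ≡ ∑[ y ∈ ys ] (⟦ weight y ≡ᵇ k ⟧ * ⟦ diffCount x y ≡ᵇ 2 ⟧ * extend F y)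
  ∑-selectNbrs F x []       = refl
  ∑-selectNbrs F x (y ∷ ys) with weight y ℕ.≟ k | diffCount x y ℕ.≟ 2
  ... | yes w | yes d = cong₂ _+_ (sym selected) (∑-selectNbrs F x ys)
    where
    selected : ⟦ weight y ≡ᵇ k ⟧ * ⟦ diffCount x y ≡ᵇ 2 ⟧ * F (y , w) ≡ F (y , w)
    selected = trans (cong₂ (λ a b → ⟦ a ⟧ * ⟦ b ⟧ * F (y , w)) (dec-true (weight y ℕ.≟ k) w) (dec-true (diffCount x y ℕ.≟ 2) d))
                     (ℚ.*-identityˡ (F (y , w)))
  ... | yes _ | no d̸  = trans (∑-selectNbrs F x ys) (sym (+-identityˡ′ _ dropped))
    where
    dropped : ∀ {a} → ⟦ weight y ≡ᵇ k ⟧ * ⟦ diffCount x y ≡ᵇ 2 ⟧ * a ≡ 0ℚ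
    dropped {a} = trans (cong (λ b → ⟦ weight y ≡ᵇ k ⟧ * ⟦ b ⟧ * a) (dec-false (diffCount x y ℕ.≟ 2) d̸))
                        (x*0*y≡0 ⟦ weight y ≡ᵇ k ⟧ a)
  ... | no w̸  | _     = trans (∑-selectNbrs F x ys) (sym (+-identityˡ′ _ dropped))
    where
    dropped : ∀ {a} → ⟦ weight y ≡ᵇ k ⟧ * ⟦ diffCount x y ≡ᵇ 2 ⟧ * a ≡ 0ℚ
    dropped {a} = trans (cong (λ b → ⟦ b ⟧ * ⟦ diffCount x y ≡ᵇ 2 ⟧ * a) (dec-false (weight y ℕ.≟ k) w̸))
                        (0*x*y≡0 ⟦ diffCount x y ≡ᵇ 2 ⟧ a)

∑-nbrs-J : ∀ {n k} (F : Vertex n k → ℚ) (v : Vertex n k) →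
           ∑ₗ (Graph.nbrs (J n k) v) F
           ≡ ∑² (λ p q → ⟦ lookup (proj₁ v) p ⟧ * ⟦ not (lookup (proj₁ v) q) ⟧ * F (swapᵛ p q v))
∑-nbrs-J {n} F (x , refl) = begin
  ∑ₗ (selectNbrs (weight x) x (allVecs n)) F
    ≡⟨ ∑-selectNbrs F x (allVecs n) ⟩
  ∑[ y ∈ allVecs n ] (⟦ weight y ≡ᵇ weight x ⟧ * ⟦ diffCount x y ≡ᵇ 2 ⟧ * extend F y)
    ≡⟨ ∑ₗ-allVecs n _ ⟩
  ∑ᵛ (λ y → ⟦ weight y ≡ᵇ weight x ⟧ * ⟦ diffCount x y ≡ᵇ 2 ⟧ * extend F y)
    ≡⟨ ∑ᵛ-swap x (extend F) ⟩
  ∑² (λ p q → ⟦ lookup x p ⟧ * ⟦ not (lookup x q) ⟧ * extend F (swap p q x))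
    ≡⟨ ∑²-cong (λ p q → cong (⟦ lookup x p ⟧ * ⟦ not (lookup x q) ⟧ *_) (extend-vertex F _ (trans (weight-swap x p q) refl))) ⟩
  ∑² (λ p q → ⟦ lookup x p ⟧ * ⟦ not (lookup x q) ⟧ * F (swapᵛ p q (x , refl))) ∎
  where open ≡-Reasoning

vertex-≡ : ∀ {n k} {u u′ : Vertex n k} → proj₁ u ≡ proj₁ u′ → u ≡ u′
vertex-≡ {u = y , w} {.y , w′} refl = cong (y ,_) (ℕₚ.≡-irrelevant w w′)

∑-weight : ∀ {n} (y : Vec Bool n) → ∑[ p < n ] ⟦ lookup y p ⟧ ≡ fromℕ (weight y)
∑-weight []          = refl
∑-weight (true ∷ y)  = cong (1ℚ +_) (∑-weight y)
∑-weight (false ∷ y) = trans (ℚ.+-identityˡ _) (∑-weight y)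

degree-J : ∀ {n k} (u : Vertex n k) → ∑[ _ ∈ Graph.nbrs (J n k) u ] 1ℚ ≡ fromℕ k * (fromℕ n - fromℕ k)
degree-J {n} (y , refl) = begin
  ∑[ _ ∈ Graph.nbrs (J n (weight y)) (y , refl) ] 1ℚ
    ≡⟨ ∑-nbrs-J (λ _ → 1ℚ) (y , refl) ⟩
  ∑² (λ p q → ⟦ lookup y p ⟧ * ⟦ not (lookup y q) ⟧ * 1ℚ)
    ≡⟨ ∑²-cong (λ p q → ℚ.*-identityʳ (⟦ lookup y p ⟧ * ⟦ not (lookup y q) ⟧)) ⟩
  ∑² (λ p q → ⟦ lookup y p ⟧ * ⟦ not (lookup y q) ⟧)
    ≡⟨ sum-cong-≗ (λ p → sym (*-distribˡ-sum ⟦ lookup y p ⟧ (λ q → ⟦ not (lookup y q) ⟧))) ⟩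
  ∑[ p < n ] (⟦ lookup y p ⟧ * ∑[ q < n ] ⟦ not (lookup y q) ⟧)
    ≡⟨ *-distribʳ-sum (∑[ q < n ] ⟦ not (lookup y q) ⟧) (λ p → ⟦ lookup y p ⟧) ⟨
  ∑[ p < n ] ⟦ lookup y p ⟧ * ∑[ q < n ] ⟦ not (lookup y q) ⟧
    ≡⟨ cong₂ _*_ (∑-weight y) (trans (sum-cong-≗ (⟦not⟧ ∘ lookup y)) (trans (∑-distrib-sub (λ _ → 1ℚ) (⟦_⟧ ∘ lookup y))
                                  (cong₂ _-_ (∑-1 n) (∑-weight y)))) ⟩
  fromℕ (weight y) * (fromℕ n - fromℕ (weight y)) ∎
  where open ≡-Reasoning

-- The sum-of-squares decomposition of Γ₂

module _ {n : ℕ} where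

  row-identity : ∀ (σ τ : Fin n → ℚ) → (∀ q → τ q * τ q ≡ τ q) → ∀ (b : Fin n → Fin n → ℚ) →
    ∑² (λ p q → σ p * τ q * ∑[ q′ < n ] (τ q′ * δᶜ q q′ * (b p q′ - 2ℚ * b p q) ²))
    ≡ 2ℚ * ∑³ (λ p q q′ → σ p * τ q * τ q′ * (b p q - b p q′) ²)
      + sum τ * ∑² (λ p q → σ p * τ q * b p q ²) - ∑² (λ p q → σ p * τ q * b p q ²)
  row-identity σ τ τ-idem b = begin
    ∑² (λ p q → σ p * τ q * ∑[ q′ < n ] (τ q′ * δᶜ q q′ * (b p q′ - 2ℚ * b p q) ²))
      ≡⟨ ∑²-cong (λ p q → *-distribˡ-sum (σ p * τ q) (λ q′ → τ q′ * δᶜ q q′ * (b p q′ - 2ℚ * b p q) ²)) ⟩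
    ∑³ (λ p q q′ → σ p * τ q * (τ q′ * δᶜ q q′ * (b p q′ - 2ℚ * b p q) ²))
      ≡⟨ ∑³-cong expand ⟩
    ∑³ (λ p q q′ → u₁ p q q′ + u₂ p q q′ - u₃ p q q′ - u₄ p q q′)
      ≡⟨ trans (∑³-distrib-sub _ u₄) (cong (_- ∑³ u₄)
           (trans (∑³-distrib-sub _ u₃) (cong (_- ∑³ u₃) (∑³-distrib-+ u₁ u₂)))) ⟩
    ∑³ u₁ + ∑³ u₂ - ∑³ u₃ - ∑³ u₄
      ≡⟨ cong₂ _-_ (cong₂ _-_ (cong₂ _+_ (sym (*-distribˡ-∑³ 2ℚ R)) ∑u₂) ∑u₃) ∑u₄ ⟩
    2ℚ * ∑³ R + sum τ * (2ℚ * B) - sum τ * B - B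
      ≡⟨ solve 3 (λ R m B → con 2ℚ :* R :+ m :* (con 2ℚ :* B) :- m :* B :- B := con 2ℚ :* R :+ m :* B :- B)
               refl (∑³ R) (sum τ) B ⟩
    2ℚ * ∑³ R + sum τ * B - B ∎
    where
    open ≡-Reasoning
    R u₁ u₂ u₃ u₄ : Fin n → Fin n → Fin n → ℚ
    R  p q q′ = σ p * τ q * τ q′ * (b p q - b p q′) ²
    u₁ p q q′ = 2ℚ * R p q q′
    u₂ p q q′ = 2ℚ * (σ p * τ q * b p q ²) * τ q′
    u₃ p q q′ = σ p * τ q′ * τ q * b p q′ ²
    u₄ p q q′ = δ q q′ * (σ p * τ q * (τ q′ * (b p q′ - 2ℚ * b p q) ²))
    B : ℚ
    B = ∑² (λ p q → σ p * τ q * b p q ²)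

    expand : ∀ p q q′ → σ p * τ q * (τ q′ * δᶜ q q′ * (b p q′ - 2ℚ * b p q) ²)
                        ≡ u₁ p q q′ + u₂ p q q′ - u₃ p q q′ - u₄ p q q′
    expand p q q′ = trans (cong (λ d → σ p * τ q * (τ q′ * d * (b p q′ - 2ℚ * b p q) ²)) (δᶜ≡1-δ q q′))
      (solve 6 (λ s t t′ d c c′ →
          s :* t :* (t′ :* (con 1ℚ :- d) :* ((c′ :- con 2ℚ :* c) :* (c′ :- con 2ℚ :* c)))
          := con 2ℚ :* (s :* t :* t′ :* ((c :- c′) :* (c :- c′))) :+ con 2ℚ :* (s :* t :* (c :* c)) :* t′
             :- s :* t′ :* t :* (c′ :* c′) :- d :* (s :* t :* (t′ :* ((c′ :- con 2ℚ :* c) :* (c′ :- con 2ℚ :* c)))))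
        refl (σ p) (τ q) (τ q′) (δ q q′) (b p q) (b p q′))

    factor-τ : ∀ (c : Fin n → Fin n → ℚ) → ∑³ (λ p q q′ → c p q * τ q′) ≡ sum τ * ∑² c
    factor-τ c = begin
      ∑³ (λ p q q′ → c p q * τ q′)  ≡⟨ ∑²-cong (λ p q → sym (*-distribˡ-sum (c p q) τ)) ⟩
      ∑² (λ p q → c p q * sum τ)    ≡⟨ ∑²-cong (λ p q → ℚ.*-comm (c p q) (sum τ)) ⟩
      ∑² (λ p q → sum τ * c p q)    ≡⟨ *-distribˡ-∑² (sum τ) c ⟨
      sum τ * ∑² c                  ∎

    ∑u₂ : ∑³ u₂ ≡ sum τ * (2ℚ * B)
    ∑u₂ = trans (factor-τ (λ p q → 2ℚ * (σ p * τ q * b p q ²)))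
                (cong (sum τ *_) (sym (*-distribˡ-∑² 2ℚ (λ p q → σ p * τ q * b p q ²))))

    ∑u₃ : ∑³ u₃ ≡ sum τ * B
    ∑u₃ = begin
      ∑³ u₃
        ≡⟨ sum-cong-≗ (λ p → ∑-comm (u₃ p)) ⟩
      ∑³ (λ p q q′ → σ p * τ q * τ q′ * b p q ²)
        ≡⟨ ∑³-cong (λ p q q′ → solve 4 (λ s t t′ c → s :* t :* t′ :* c := s :* t :* c :* t′)
                                       refl (σ p) (τ q) (τ q′) (b p q ²)) ⟩
      ∑³ (λ p q q′ → σ p * τ q * b p q ² * τ q′)
        ≡⟨ factor-τ (λ p q → σ p * τ q * b p q ²) ⟩
      sum τ * B ∎

    ∑u₄ : ∑³ u₄ ≡ B
    ∑u₄ = ∑²-cong λ p q → begin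
      ∑[ q′ < n ] u₄ p q q′
        ≡⟨ ∑-δ q (λ q′ → σ p * τ q * (τ q′ * (b p q′ - 2ℚ * b p q) ²)) ⟩
      σ p * τ q * (τ q * (b p q - 2ℚ * b p q) ²)
        ≡⟨ solve 3 (λ s t c → s :* t :* (t :* ((c :- con 2ℚ :* c) :* (c :- con 2ℚ :* c))) := s :* (t :* t) :* (c :* c))
                 refl (σ p) (τ q) (b p q) ⟩
      σ p * (τ q * τ q) * b p q ²
        ≡⟨ cong (λ t → σ p * t * b p q ²) (τ-idem q) ⟩
      σ p * τ q * b p q ² ∎

corner-form : ℚ → ℚ → ℚ → ℚ → ℚ → ℚ
corner-form w a₁ a₂ a₃ a₄ = (w - ½ * (a₁ + a₂ + a₃ + a₄)) ² + ¼ * (a₁ - a₂ - a₃ + a₄) ² + (a₁ - a₄) ²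

four-squares : ∀ w a₁ a₂ a₃ a₄ →
  (w - 2ℚ * a₁) ² + (w - 2ℚ * a₃) ² + (w - 2ℚ * a₂) ² + (w - 2ℚ * a₄) ²
  ≡ corner-form w a₁ a₂ a₃ a₄ + corner-form w a₃ a₄ a₁ a₂ + corner-form w a₂ a₁ a₄ a₃ + corner-form w a₄ a₃ a₂ a₁
four-squares = solve 5 (λ w a₁ a₂ a₃ a₄ →
    sq (w :- con 2ℚ :* a₁) :+ sq (w :- con 2ℚ :* a₃) :+ sq (w :- con 2ℚ :* a₂) :+ sq (w :- con 2ℚ :* a₄)
    := form w a₁ a₂ a₃ a₄ :+ form w a₃ a₄ a₁ a₂ :+ form w a₂ a₁ a₄ a₃ :+ form w a₄ a₃ a₂ a₁) refl
  where
  sq : ∀ {k} → Polynomial k → Polynomial k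
  sq e = e :* e
  form : ∀ {k} → Polynomial k → Polynomial k → Polynomial k → Polynomial k → Polynomial k → Polynomial k
  form w a₁ a₂ a₃ a₄ = sq (w :- con ½ :* (a₁ :+ a₂ :+ a₃ :+ a₄)) :+ con ¼ :* sq (a₁ :- a₂ :- a₃ :+ a₄) :+ sq (a₁ :- a₄)

-- p ranges over the ones of x and q over its zeros (weights σ and τ); a p q stands for the increment
-- of f along the swap of p and q, and W p q p′ q′ for its increment after a further swap of p′ and q′.
module SumOfSquares {n : ℕ} (x : Vec Bool n) (a : Fin n → Fin n → ℚ) (W : Fin n → Fin n → Fin n → Fin n → ℚ)
  (W-exchange-ones  : ∀ {p q p′ q′} → DisjointSwaps x p q p′ q′ → W p′ q p q′ ≡ W p q p′ q′)
  (W-exchange-zeros : ∀ {p q p′ q′} → DisjointSwaps x p q p′ q′ → W p q′ p′ q ≡ W p q p′ q′) where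

  σ τ : Fin n → ℚ
  σ p = ⟦ lookup x p ⟧
  τ q = ⟦ not (lookup x q) ⟧

  χ : Fin n → Fin n → ℚ
  χ p q = σ p * τ q

  M : Fin n → Fin n → Fin n → Fin n → ℚ
  M p q p′ q′ = χ p q * (σ p′ * δᶜ p p′ * (τ q′ * δᶜ q q′))

  row col corner : Fin n → Fin n → ℚ
  row p q    = ∑[ q′ < n ] (τ q′ * δᶜ q q′ * (a p q′ - 2ℚ * a p q) ²)
  col p q    = ∑[ p′ < n ] (σ p′ * δᶜ p p′ * (a p′ q - 2ℚ * a p q) ²)
  corner p q = ∑² (λ p′ q′ → σ p′ * δᶜ p p′ * (τ q′ * δᶜ q q′) * (W p q p′ q′ - 2ℚ * a p q) ²)

  energy twoStepSum pairSum rowVar colVar cornerDev mixedDiff crossDiff squares : ℚ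
  energy     = ∑² (λ p q → χ p q * a p q ²)
  twoStepSum = ∑² (λ p q → χ p q * (4ℚ * a p q ² + row p q + col p q + corner p q))
  pairSum    = ∑² (λ p q → χ p q * ∑² (λ p′ q′ → χ p′ q′ * (a p q - a p′ q′) ²))
  rowVar     = ∑³ (λ p q q′ → σ p * τ q * τ q′ * (a p q - a p q′) ²)
  colVar     = ∑³ (λ q p p′ → τ q * σ p * σ p′ * (a p q - a p′ q) ²)
  cornerDev  = ∑⁴ (λ p q p′ q′ → M p q p′ q′ * (W p q p′ q′ - ½ * (a p q + a p q′ + a p′ q + a p′ q′)) ²)
  mixedDiff  = ∑⁴ (λ p q p′ q′ → M p q p′ q′ * (a p q - a p q′ - a p′ q + a p′ q′) ²)
  crossDiff  = ∑⁴ (λ p q p′ q′ → M p q p′ q′ * (a p q - a p′ q′) ²)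
  squares    = cornerDev + ¼ * mixedDiff + rowVar + colVar

  σ-idem : ∀ p → σ p * σ p ≡ σ p
  σ-idem p = ⟦⟧-idem (lookup x p)

  τ-idem : ∀ q → τ q * τ q ≡ τ q
  τ-idem q = ⟦⟧-idem (not (lookup x q))

  ∑σ+∑τ : sum σ + sum τ ≡ ∑[ i < n ] 1ℚ
  ∑σ+∑τ = trans (sym (∑-distrib-+ σ τ)) (sum-cong-≗ λ i → σ+τ (lookup x i))
    where
    σ+τ : ∀ b → ⟦ b ⟧ + ⟦ not b ⟧ ≡ 1ℚ
    σ+τ true  = refl
    σ+τ false = refl

  M-exchangeˡ : ∀ p q p′ q′ → M p′ q p q′ ≡ M p q p′ q′
  M-exchangeˡ p q p′ q′ = trans (cong (λ d → χ p′ q * (σ p * d * (τ q′ * δᶜ q q′))) (δᶜ-sym p′ p))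
    (solve 6 (λ s t s′ d t′ e → s′ :* t :* (s :* d :* (t′ :* e)) := s :* t :* (s′ :* d :* (t′ :* e)))
           refl (σ p) (τ q) (σ p′) (δᶜ p p′) (τ q′) (δᶜ q q′))

  M-exchangeʳ : ∀ p q p′ q′ → M p q′ p′ q ≡ M p q p′ q′
  M-exchangeʳ p q p′ q′ = trans (cong (λ d → χ p q′ * (σ p′ * δᶜ p p′ * (τ q * d))) (δᶜ-sym q′ q))
    (solve 6 (λ s t s′ d t′ e → s :* t′ :* (s′ :* d :* (t :* e)) := s :* t :* (s′ :* d :* (t′ :* e)))
           refl (σ p) (τ q) (σ p′) (δᶜ p p′) (τ q′) (δᶜ q q′))

  M-guard : ∀ p q p′ q′ {X Y} → (DisjointSwaps x p q p′ q′ → X ≡ Y) → M p q p′ q′ * X ≡ M p q p′ q′ * Y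
  M-guard p q p′ q′ {X} {Y} X≡Y = begin
    M p q p′ q′ * X                                           ≡⟨ nest X ⟩
    σ p * (τ q * (σ p′ * (δᶜ p p′ * (τ q′ * (δᶜ q q′ * X))))) ≡⟨ guarded ⟩
    σ p * (τ q * (σ p′ * (δᶜ p p′ * (τ q′ * (δᶜ q q′ * Y))))) ≡⟨ nest Y ⟨
    M p q p′ q′ * Y                                           ∎
    where
    open ≡-Reasoning
    nest : ∀ Z → M p q p′ q′ * Z ≡ σ p * (τ q * (σ p′ * (δᶜ p p′ * (τ q′ * (δᶜ q q′ * Z)))))
    nest = solve 7 (λ s t s′ d t′ e Z → s :* t :* (s′ :* d :* (t′ :* e)) :* Z := s :* (t :* (s′ :* (d :* (t′ :* (e :* Z))))))
                   refl (σ p) (τ q) (σ p′) (δᶜ p p′) (τ q′) (δᶜ q q′)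
    guarded : σ p * (τ q * (σ p′ * (δᶜ p p′ * (τ q′ * (δᶜ q q′ * X)))))
              ≡ σ p * (τ q * (σ p′ * (δᶜ p p′ * (τ q′ * (δᶜ q q′ * Y)))))
    guarded = ⟦⟧*-cong (lookup x p) λ p∈x → ⟦⟧*-cong (not (lookup x q)) λ q∉x →
              ⟦⟧*-cong (lookup x p′) λ p′∈x → ⟦⟧*-cong (not (does (p ≟ p′))) λ p≢p′ →
              ⟦⟧*-cong (not (lookup x q′)) λ q′∉x → ⟦⟧*-cong (not (does (q ≟ q′))) λ q≢q′ →
              X≡Y (record { p∈x = p∈x ; q∉x = not≡true⇒≡false q∉x ; p′∈x = p′∈x ; q′∉x = not≡true⇒≡false q′∉x
                          ; p≢p′ = not-does⇒≢ p≢p′ ; q≢q′ = not-does⇒≢ q≢q′ })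

  twoStepSum-split : twoStepSum ≡ 4ℚ * energy + ∑² (λ p q → χ p q * row p q) + ∑² (λ p q → χ p q * col p q)
                                           + ∑² (λ p q → χ p q * corner p q)
  twoStepSum-split = begin
    twoStepSum
      ≡⟨ ∑²-cong (λ p q →
           solve 5 (λ c a² r k d → c :* (con 4ℚ :* a² :+ r :+ k :+ d) := con 4ℚ :* (c :* a²) :+ c :* r :+ c :* k :+ c :* d)
                 refl (χ p q) (a p q ²) (row p q) (col p q) (corner p q)) ⟩
    ∑² (λ p q → g₁ p q + g₂ p q + g₃ p q + g₄ p q)
      ≡⟨ ∑²-distrib-+₄ g₁ g₂ g₃ g₄ ⟩
    ∑² g₁ + ∑² g₂ + ∑² g₃ + ∑² g₄
      ≡⟨ cong (λ t → t + ∑² g₂ + ∑² g₃ + ∑² g₄) (sym (*-distribˡ-∑² 4ℚ (λ p q → χ p q * a p q ²))) ⟩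
    4ℚ * energy + ∑² g₂ + ∑² g₃ + ∑² g₄ ∎
    where
    open ≡-Reasoning
    g₁ g₂ g₃ g₄ : Fin n → Fin n → ℚ
    g₁ p q = 4ℚ * (χ p q * a p q ²)
    g₂ p q = χ p q * row p q
    g₃ p q = χ p q * col p q
    g₄ p q = χ p q * corner p q

  rows : ∑² (λ p q → χ p q * row p q) ≡ 2ℚ * rowVar + sum τ * energy - energy
  rows = row-identity σ τ τ-idem a

  cols : ∑² (λ p q → χ p q * col p q) ≡ 2ℚ * colVar + sum σ * energy - energy
  cols = begin
    ∑² (λ p q → χ p q * col p q)
      ≡⟨ ∑²-transpose σ τ col ⟩
    ∑² (λ q p → τ q * σ p * col p q)
      ≡⟨ row-identity τ σ σ-idem (λ q p → a p q) ⟩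
    2ℚ * colVar + sum σ * Aᵀ - Aᵀ
      ≡⟨ cong (λ B → 2ℚ * colVar + sum σ * B - B) (∑²-transpose σ τ (λ p q → a p q ²)) ⟨
    2ℚ * colVar + sum σ * energy - energy ∎
    where
    open ≡-Reasoning
    Aᵀ : ℚ
    Aᵀ = ∑² (λ q p → τ q * σ p * a p q ²)

  -- Averaging over the relabellings p ↔ p′ and q ↔ q′, which fix W, lets four-squares rewrite
  -- each (W − 2a)² as corner-forms.
  corners : ∑² (λ p q → χ p q * corner p q) ≡ cornerDev + ¼ * mixedDiff + crossDiff
  corners = begin
    ∑² (λ p q → χ p q * corner p q)
      ≡⟨ ∑²-cong (λ p q → trans (*-distribˡ-∑² (χ p q) (λ p′ q′ → m p q p′ q′ * F p q p′ q′))
                                (∑²-cong λ p′ q′ → sym (ℚ.*-assoc (χ p q) (m p q p′ q′) (F p q p′ q′)))) ⟩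
    ∑⁴ (λ p q p′ q′ → M p q p′ q′ * F p q p′ q′)
      ≡⟨ 4*-injective (begin
           4ℚ * ∑⁴ (λ p q p′ q′ → M p q p′ q′ * F p q p′ q′)
             ≡⟨ symmetrise M F M-exchangeˡ M-exchangeʳ ⟩
           ∑⁴ (λ p q p′ q′ → M p q p′ q′ * (F p q p′ q′ + F p′ q p q′ + F p q′ p′ q + F p′ q′ p q))
             ≡⟨ ∑⁴-cong (λ p q p′ q′ → M-guard p q p′ q′ (four-squares-at p q p′ q′)) ⟩
           ∑⁴ (λ p q p′ q′ → M p q p′ q′ * (T p q p′ q′ + T p′ q p q′ + T p q′ p′ q + T p′ q′ p q))
             ≡⟨ symmetrise M T M-exchangeˡ M-exchangeʳ ⟨
           4ℚ * ∑⁴ (λ p q p′ q′ → M p q p′ q′ * T p q p′ q′) ∎) ⟩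
    ∑⁴ (λ p q p′ q′ → M p q p′ q′ * T p q p′ q′)
      ≡⟨ ∑⁴-cong (λ p q p′ q′ → solve 4 (λ m u v w → m :* (u :+ con ¼ :* v :+ w) := m :* u :+ con ¼ :* (m :* v) :+ m :* w)
                                         refl (M p q p′ q′) ((W p q p′ q′ - ½ * (a p q + a p q′ + a p′ q + a p′ q′)) ²)
                                              ((a p q - a p q′ - a p′ q + a p′ q′) ²) ((a p q - a p′ q′) ²)) ⟩
    ∑⁴ (λ p q p′ q′ → h₁ p q p′ q′ + ¼ * h₂ p q p′ q′ + h₃ p q p′ q′)
      ≡⟨ trans (∑⁴-distrib-+ _ h₃) (cong (_+ crossDiff)
           (trans (∑⁴-distrib-+ h₁ _) (cong (cornerDev +_) (sym (*-distribˡ-∑⁴ ¼ h₂))))) ⟩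
    cornerDev + ¼ * mixedDiff + crossDiff ∎
    where
    open ≡-Reasoning
    m F T h₁ h₂ h₃ : Fin n → Fin n → Fin n → Fin n → ℚ
    m p q p′ q′ = σ p′ * δᶜ p p′ * (τ q′ * δᶜ q q′)
    F p q p′ q′ = (W p q p′ q′ - 2ℚ * a p q) ²
    T p q p′ q′ = corner-form (W p q p′ q′) (a p q) (a p q′) (a p′ q) (a p′ q′)
    h₁ p q p′ q′ = M p q p′ q′ * (W p q p′ q′ - ½ * (a p q + a p q′ + a p′ q + a p′ q′)) ²
    h₂ p q p′ q′ = M p q p′ q′ * (a p q - a p q′ - a p′ q + a p′ q′) ²
    h₃ p q p′ q′ = M p q p′ q′ * (a p q - a p′ q′) ²

    four-squares-at : ∀ p q p′ q′ → DisjointSwaps x p q p′ q′ →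
      F p q p′ q′ + F p′ q p q′ + F p q′ p′ q + F p′ q′ p q ≡ T p q p′ q′ + T p′ q p q′ + T p q′ p′ q + T p′ q′ p q
    four-squares-at p q p′ q′ d
      rewrite W-exchange-ones d | W-exchange-zeros d
            | W-exchange-zeros (exchange-ones d) | W-exchange-ones d
      = four-squares (W p q p′ q′) (a p q) (a p q′) (a p′ q) (a p′ q′)

  crossDiff-split : crossDiff ≡ pairSum - rowVar - colVar
  crossDiff-split = begin
    crossDiff
      ≡⟨ ∑⁴-cong expand ⟩
    ∑⁴ (λ p q p′ q′ → E₁ p q p′ q′ - E₂ p q p′ q′ - E₃ p q p′ q′ + E₄ p q p′ q′)
      ≡⟨ trans (∑⁴-distrib-+ _ E₄) (cong (_+ ∑⁴ E₄)
           (trans (∑⁴-distrib-sub _ E₃) (cong (_- ∑⁴ E₃) (∑⁴-distrib-sub E₁ E₂)))) ⟩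
    ∑⁴ E₁ - ∑⁴ E₂ - ∑⁴ E₃ + ∑⁴ E₄
      ≡⟨ cong₂ _+_ (cong₂ _-_ (cong₂ _-_ ∑E₁ ∑E₂) ∑E₃) ∑E₄ ⟩
    pairSum - rowVar - colVar + 0ℚ
      ≡⟨ ℚ.+-identityʳ _ ⟩
    pairSum - rowVar - colVar ∎
    where
    open ≡-Reasoning
    G E₁ E₂ E₃ E₄ : Fin n → Fin n → Fin n → Fin n → ℚ
    G  p q p′ q′ = χ p q * (σ p′ * (τ q′ * (a p q - a p′ q′) ²))
    E₁ p q p′ q′ = χ p q * (χ p′ q′ * (a p q - a p′ q′) ²)
    E₂ p q p′ q′ = δ p p′ * G p q p′ q′
    E₃ p q p′ q′ = δ q q′ * G p q p′ q′
    E₄ p q p′ q′ = δ p p′ * (δ q q′ * G p q p′ q′)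

    expand : ∀ p q p′ q′ → M p q p′ q′ * (a p q - a p′ q′) ²
                           ≡ E₁ p q p′ q′ - E₂ p q p′ q′ - E₃ p q p′ q′ + E₄ p q p′ q′
    expand p q p′ q′ =
      trans (cong₂ (λ u v → χ p q * (σ p′ * u * (τ q′ * v)) * (a p q - a p′ q′) ²) (δᶜ≡1-δ p p′) (δᶜ≡1-δ q q′))
      (solve 6 (λ c s′ t′ d e X →
          c :* (s′ :* (con 1ℚ :- d) :* (t′ :* (con 1ℚ :- e))) :* X
          := c :* (s′ :* t′ :* X) :- d :* (c :* (s′ :* (t′ :* X))) :- e :* (c :* (s′ :* (t′ :* X)))
             :+ d :* (e :* (c :* (s′ :* (t′ :* X)))))
        refl (χ p q) (σ p′) (τ q′) (δ p p′) (δ q q′) ((a p q - a p′ q′) ²))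

    ∑E₁ : ∑⁴ E₁ ≡ pairSum
    ∑E₁ = ∑²-cong λ p q → sym (*-distribˡ-∑² (χ p q) (λ p′ q′ → χ p′ q′ * (a p q - a p′ q′) ²))

    ∑E₂ : ∑⁴ E₂ ≡ rowVar
    ∑E₂ = ∑²-cong λ p q → trans (∑²-δ p (G p q)) (sum-cong-≗ λ q′ → begin
      σ p * τ q * (σ p * (τ q′ * (a p q - a p q′) ²))
        ≡⟨ solve 4 (λ s t t′ X → s :* t :* (s :* (t′ :* X)) := s :* s :* t :* t′ :* X)
                 refl (σ p) (τ q) (τ q′) ((a p q - a p q′) ²) ⟩
      σ p * σ p * τ q * τ q′ * (a p q - a p q′) ²
        ≡⟨ cong (λ s → s * τ q * τ q′ * (a p q - a p q′) ²) (σ-idem p) ⟩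
      σ p * τ q * τ q′ * (a p q - a p q′) ² ∎)

    ∑E₃ : ∑⁴ E₃ ≡ colVar
    ∑E₃ = trans (∑³-cong λ p q p′ → trans (∑-δ q (G p q p′)) (begin
      σ p * τ q * (σ p′ * (τ q * (a p q - a p′ q) ²))
        ≡⟨ solve 4 (λ s t s′ X → s :* t :* (s′ :* (t :* X)) := t :* t :* s :* s′ :* X)
                 refl (σ p) (τ q) (σ p′) ((a p q - a p′ q) ²) ⟩
      τ q * τ q * σ p * σ p′ * (a p q - a p′ q) ²
        ≡⟨ cong (λ t → t * σ p * σ p′ * (a p q - a p′ q) ²) (τ-idem q) ⟩
      τ q * σ p * σ p′ * (a p q - a p′ q) ² ∎))
      (∑-comm (λ p q → ∑[ p′ < n ] (τ q * σ p * σ p′ * (a p q - a p′ q) ²)))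

    ∑E₄ : ∑⁴ E₄ ≡ 0ℚ
    ∑E₄ = ∑-zero λ p → ∑-zero λ q → begin
      ∑² (λ p′ q′ → δ p p′ * (δ q q′ * G p q p′ q′))  ≡⟨ ∑²-δ p (λ p′ q′ → δ q q′ * G p q p′ q′) ⟩
      ∑[ q′ < n ] (δ q q′ * G p q p q′)              ≡⟨ ∑-δ q (G p q p) ⟩
      G p q p q                                      ≡⟨ solve 4 (λ c s t A → c :* (s :* (t :* ((A :- A) :* (A :- A)))) := con 0ℚ)
                                                              refl (χ p q) (σ p) (τ q) (a p q) ⟩
      0ℚ                                             ∎

  sum-of-squares : twoStepSum - pairSum - (2ℚ + ∑[ i < n ] 1ℚ) * energy ≡ squares
  sum-of-squares = begin
    twoStepSum - pairSum - (2ℚ + ∑[ i < n ] 1ℚ) * energy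
      ≡⟨ cong₂ (λ t s → t - pairSum - (2ℚ + s) * energy) expanded (sym ∑σ+∑τ) ⟩
    4ℚ * energy + (2ℚ * rowVar + sum τ * energy - energy) + (2ℚ * colVar + sum σ * energy - energy)
      + (cornerDev + ¼ * mixedDiff + (pairSum - rowVar - colVar)) - pairSum - (2ℚ + (sum σ + sum τ)) * energy
      ≡⟨ solve 8 (λ E R C D P T k m →
           con 4ℚ :* E :+ (con 2ℚ :* R :+ m :* E :- E) :+ (con 2ℚ :* C :+ k :* E :- E)
             :+ (D :+ con ¼ :* P :+ (T :- R :- C)) :- T :- (con 2ℚ :+ (k :+ m)) :* E
           := D :+ con ¼ :* P :+ R :+ C)
         refl energy rowVar colVar cornerDev mixedDiff pairSum (sum σ) (sum τ) ⟩
    squares ∎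
    where
    open ≡-Reasoning
    expanded : twoStepSum ≡ 4ℚ * energy + (2ℚ * rowVar + sum τ * energy - energy) + (2ℚ * colVar + sum σ * energy - energy)
                            + (cornerDev + ¼ * mixedDiff + (pairSum - rowVar - colVar))
    expanded = trans twoStepSum-split
      (cong₂ _+_ (cong₂ _+_ (cong (4ℚ * energy +_) rows) cols) (trans corners (cong (cornerDev + ¼ * mixedDiff +_) crossDiff-split)))

  squares-vanish : ∀ c → (∀ {p q} → lookup x p ≡ true → lookup x q ≡ false → a p q ≡ c) →
                   (∀ {p q p′ q′} → DisjointSwaps x p q p′ q′ → W p q p′ q′ ≡ 2ℚ * c) → squares ≡ 0ℚ
  squares-vanish c a≡c W≡2c = begin
    cornerDev + ¼ * mixedDiff + rowVar + colVar
      ≡⟨ cong₂ _+_ (cong₂ _+_ (cong₂ _+_ cornerDev≡0 (cong (¼ *_) mixedDiff≡0)) rowVar≡0) colVar≡0 ⟩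
    0ℚ + ¼ * 0ℚ + 0ℚ + 0ℚ
      ≡⟨⟩
    0ℚ ∎
    where
    open ≡-Reasoning
    module D = DisjointSwaps

    cornerDev-term : ∀ {p q p′ q′} → DisjointSwaps x p q p′ q′ →
                     (W p q p′ q′ - ½ * (a p q + a p q′ + a p′ q + a p′ q′)) ² ≡ 0ℚ
    cornerDev-term d rewrite W≡2c d | a≡c (D.p∈x d) (D.q∉x d) | a≡c (D.p∈x d) (D.q′∉x d)
                           | a≡c (D.p′∈x d) (D.q∉x d) | a≡c (D.p′∈x d) (D.q′∉x d) =
      solve 1 (λ c → (con 2ℚ :* c :- con ½ :* (c :+ c :+ c :+ c)) :* (con 2ℚ :* c :- con ½ :* (c :+ c :+ c :+ c)) := con 0ℚ) refl c

    mixedDiff-term : ∀ {p q p′ q′} → DisjointSwaps x p q p′ q′ → (a p q - a p q′ - a p′ q + a p′ q′) ² ≡ 0ℚ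
    mixedDiff-term d rewrite a≡c (D.p∈x d) (D.q∉x d) | a≡c (D.p∈x d) (D.q′∉x d)
                           | a≡c (D.p′∈x d) (D.q∉x d) | a≡c (D.p′∈x d) (D.q′∉x d) =
      solve 1 (λ c → (c :- c :- c :+ c) :* (c :- c :- c :+ c) := con 0ℚ) refl c
    guard³ : ∀ b₁ b₂ b₃ {X} → (b₁ ≡ true → b₂ ≡ true → b₃ ≡ true → X ≡ 0ℚ) →
             ⟦ b₁ ⟧ * ⟦ b₂ ⟧ * ⟦ b₃ ⟧ * X ≡ 0ℚ
    guard³ b₁ b₂ b₃ {X} X≡0 =
      trans (solve 4 (λ u v w X → u :* v :* w :* X := u :* (v :* (w :* X))) refl ⟦ b₁ ⟧ ⟦ b₂ ⟧ ⟦ b₃ ⟧ X)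
            (⟦⟧*-zero b₁ λ e₁ → ⟦⟧*-zero b₂ λ e₂ → ⟦⟧*-zero b₃ λ e₃ → X≡0 e₁ e₂ e₃)
    M-zero : ∀ p q p′ q′ {X} → (DisjointSwaps x p q p′ q′ → X ≡ 0ℚ) → M p q p′ q′ * X ≡ 0ℚ
    M-zero p q p′ q′ X≡0 = trans (M-guard p q p′ q′ X≡0) (ℚ.*-zeroʳ (M p q p′ q′))
    cornerDev≡0 : cornerDev ≡ 0ℚ
    cornerDev≡0 = ∑-zero λ p → ∑-zero λ q → ∑-zero λ p′ → ∑-zero λ q′ → M-zero p q p′ q′ cornerDev-term
    mixedDiff≡0 : mixedDiff ≡ 0ℚ
    mixedDiff≡0 = ∑-zero λ p → ∑-zero λ q → ∑-zero λ p′ → ∑-zero λ q′ → M-zero p q p′ q′ mixedDiff-term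
    rowVar≡0 : rowVar ≡ 0ℚ
    rowVar≡0 = ∑-zero λ p → ∑-zero λ q → ∑-zero λ q′ →
      guard³ (lookup x p) (not (lookup x q)) (not (lookup x q′)) λ xp xq xq′ →
      cong _² (trans (cong₂ _-_ (a≡c xp (not≡true⇒≡false xq)) (a≡c xp (not≡true⇒≡false xq′))) (ℚ.+-inverseʳ c))
    colVar≡0 : colVar ≡ 0ℚ
    colVar≡0 = ∑-zero λ q → ∑-zero λ p → ∑-zero λ p′ →
      guard³ (not (lookup x q)) (lookup x p) (lookup x p′) λ xq xp xp′ →
      cong _² (trans (cong₂ _-_ (a≡c xp (not≡true⇒≡false xq)) (a≡c xp′ (not≡true⇒≡false xq))) (ℚ.+-inverseʳ c))

  squares-nonneg : 0ℚ ≤ squares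
  squares-nonneg =
    ℚ.+-mono-≤ (ℚ.+-mono-≤ (ℚ.+-mono-≤
      (∑⁴-nonneg _ λ p q p′ q′ →
         *-nonneg (M-nonneg p q p′ q′) (²-nonneg (W p q p′ q′ - ½ * (a p q + a p q′ + a p′ q + a p′ q′))))
      (*-nonneg (ℚ.nonNegative⁻¹ ¼) (∑⁴-nonneg _ λ p q p′ q′ →
         *-nonneg (M-nonneg p q p′ q′) (²-nonneg (a p q - a p q′ - a p′ q + a p′ q′)))))
      (∑³-nonneg _ λ p q q′ → *-nonneg (*-nonneg (*-nonneg (σ≥0 p) (τ≥0 q)) (τ≥0 q′)) (²-nonneg (a p q - a p q′))))
      (∑³-nonneg _ λ q p p′ → *-nonneg (*-nonneg (*-nonneg (τ≥0 q) (σ≥0 p)) (σ≥0 p′)) (²-nonneg (a p q - a p′ q)))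
    where
    σ≥0 : ∀ i → 0ℚ ≤ σ i
    σ≥0 i = ⟦⟧-nonneg (lookup x i)
    τ≥0 : ∀ i → 0ℚ ≤ τ i
    τ≥0 i = ⟦⟧-nonneg (not (lookup x i))
    M-nonneg : ∀ p q p′ q′ → 0ℚ ≤ M p q p′ q′
    M-nonneg p q p′ q′ = *-nonneg (*-nonneg (σ≥0 p) (τ≥0 q))
      (*-nonneg (*-nonneg (σ≥0 p′) (⟦⟧-nonneg (not (does (p ≟ p′))))) (*-nonneg (τ≥0 q′) (⟦⟧-nonneg (not (does (q ≟ q′))))))

-- The curvature of J(n,k)

recentre : ∀ z y v → (z - 2ℚ * y + v) ² ≡ ((z - v) - 2ℚ * (y - v)) ²
recentre = solve 3 (λ z y v → (z :- con 2ℚ :* y :+ v) :* (z :- con 2ℚ :* y :+ v)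
                              := ((z :- v) :- con 2ℚ :* (y :- v)) :* ((z :- v) :- con 2ℚ :* (y :- v))) refl

module AtVertex {n k : ℕ} (f : Vertex n k → ℚ) (v : Vertex n k) where

  open Graph (J n k) using (nbrs)

  x : Vec Bool n
  x = proj₁ v

  Y : Fin n → Fin n → Vertex n k
  Y p q = swapᵛ p q v

  a : Fin n → Fin n → ℚ
  a p q = f (Y p q) - f v

  W : Fin n → Fin n → Fin n → Fin n → ℚ
  W p q p′ q′ = f (swapᵛ p′ q′ (Y p q)) - f v

  W-exchange-ones : ∀ {p q p′ q′} → DisjointSwaps x p q p′ q′ → W p′ q p q′ ≡ W p q p′ q′
  W-exchange-ones d = cong (λ u → f u - f v) (vertex-≡ (swap₂-exchange-ones d))

  W-exchange-zeros : ∀ {p q p′ q′} → DisjointSwaps x p q p′ q′ → W p q′ p′ q ≡ W p q p′ q′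
  W-exchange-zeros d = cong (λ u → f u - f v) (vertex-≡ (swap₂-exchange-zeros d))

  open SumOfSquares x a W W-exchange-ones W-exchange-zeros public

  -- A swap of p′ and q′ in Y p q returns to x (p′ = q, q′ = p), reaches Y p q′ (p′ = q) or Y p′ q
  -- (q′ = p), or is disjoint from the swap of p and q.
  two-steps-through : ∀ {p q} → lookup x p ≡ true → lookup x q ≡ false →
    ∑[ z ∈ nbrs (Y p q) ] ((f z - 2ℚ * f (Y p q) + f v) ²) ≡ 4ℚ * a p q ² + row p q + col p q + corner p q
  two-steps-through {p} {q} xp xq = begin
    ∑[ z ∈ nbrs (Y p q) ] ((f z - 2ℚ * f (Y p q) + f v) ²)
      ≡⟨ ∑-nbrs-J (λ z → (f z - 2ℚ * f (Y p q) + f v) ²) (Y p q) ⟩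
    ∑² (λ p′ q′ → ⟦ lookup y p′ ⟧ * ⟦ not (lookup y q′) ⟧ * G p′ q′)
      ≡⟨ ∑²-cong (λ p′ q′ →
           cong₂ (λ s t → s * t * G p′ q′) (⟦lookup-swap⟧ x xp xq p′) (⟦not-lookup-swap⟧ x xp xq q′)) ⟩
    ∑² (λ p′ q′ → (δ q p′ + σ p′ * δᶜ p p′) * (δ p q′ + τ q′ * δᶜ q q′) * G p′ q′)
      ≡⟨ ∑²-expand q p (λ p′ → σ p′ * δᶜ p p′) (λ q′ → τ q′ * δᶜ q q′) G ⟩
    G q p + ∑[ q′ < n ] (τ q′ * δᶜ q q′ * G q q′) + ∑[ p′ < n ] (σ p′ * δᶜ p p′ * G p′ p)
      + ∑² (λ p′ q′ → σ p′ * δᶜ p p′ * (τ q′ * δᶜ q q′) * G p′ q′)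
      ≡⟨ cong₂ _+_ (cong₂ _+_ (cong₂ _+_ back (sum-cong-≗ along-row)) (sum-cong-≗ along-col))
                   (∑²-cong λ p′ q′ → cong (σ p′ * δᶜ p p′ * (τ q′ * δᶜ q q′) *_)
                                              (recentre (f (swapᵛ p′ q′ (Y p q))) (f (Y p q)) (f v))) ⟩
    4ℚ * a p q ² + row p q + col p q + corner p q ∎
    where
    open ≡-Reasoning
    y : Vec Bool n
    y = swap p q x
    G : Fin n → Fin n → ℚ
    G p′ q′ = (f (swapᵛ p′ q′ (Y p q)) - 2ℚ * f (Y p q) + f v) ²

    p≢q : p ≢ q
    p≢q = ≢-by-value x xp xq

    back : G q p ≡ 4ℚ * a p q ²
    back = begin
      G q p                                        ≡⟨ cong (λ u → (f u - 2ℚ * f (Y p q) + f v) ²) (vertex-≡ (swap-involutive x p q)) ⟩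
      (f v - 2ℚ * f (Y p q) + f v) ²               ≡⟨ solve 2 (λ fv fy → (fv :- con 2ℚ :* fy :+ fv) :* (fv :- con 2ℚ :* fy :+ fv)
                                                                    := con 4ℚ :* ((fy :- fv) :* (fy :- fv))) refl (f v) (f (Y p q)) ⟩
      4ℚ * a p q ²                                 ∎

    along-row : ∀ q′ → τ q′ * δᶜ q q′ * G q q′ ≡ τ q′ * δᶜ q q′ * (a p q′ - 2ℚ * a p q) ²
    along-row q′ = ⟦⟧²*-cong (not (lookup x q′)) (not (does (q ≟ q′))) λ q′∉x q≢q′ →
      trans (cong (λ u → (f u - 2ℚ * f (Y p q) + f v) ²) (vertex-≡
               (swap-swap-merge x (trans xq (sym (not≡true⇒≡false q′∉x))) p≢q
                  (≢-by-value x xp (not≡true⇒≡false q′∉x)) (not-does⇒≢ q≢q′))))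
            (recentre (f (Y p q′)) (f (Y p q)) (f v))

    along-col : ∀ p′ → σ p′ * δᶜ p p′ * G p′ p ≡ σ p′ * δᶜ p p′ * (a p′ q - 2ℚ * a p q) ²
    along-col p′ = ⟦⟧²*-cong (lookup x p′) (not (does (p ≟ p′))) λ p′∈x p≢p′ →
      trans (cong (λ u → (f u - 2ℚ * f (Y p q) + f v) ²) (vertex-≡ (begin
               swap p′ p y              ≡⟨ trans (swap-comm y p′ p) (cong (swap p p′) (swap-comm x p q)) ⟩
               swap p p′ (swap q p x)   ≡⟨ swap-swap-merge x (trans xp (sym p′∈x)) (p≢q ∘ sym)
                                             (≢-by-value x p′∈x xq ∘ sym) (not-does⇒≢ p≢p′) ⟩
               swap q p′ x              ≡⟨ swap-comm x q p′ ⟩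
               swap p′ q x              ∎)))
            (recentre (f (Y p′ q)) (f (Y p q)) (f v))

  twoStepSum-link : ∑[ y ∈ nbrs v ] ∑[ z ∈ nbrs y ] ((f z - 2ℚ * f y + f v) ²) ≡ twoStepSum
  twoStepSum-link = trans (∑-nbrs-J (λ y → ∑[ z ∈ nbrs y ] ((f z - 2ℚ * f y + f v) ²)) v)
    (∑²-cong λ p q → ⟦⟧²*-cong (lookup x p) (not (lookup x q)) λ xp xq → two-steps-through xp (not≡true⇒≡false xq))

  pairSum-link : ∑[ y ∈ nbrs v ] ∑[ y′ ∈ nbrs v ] ((f y - f y′) ²) ≡ pairSum
  pairSum-link = trans (∑-nbrs-J (λ y → ∑[ y′ ∈ nbrs v ] ((f y - f y′) ²)) v)
    (∑²-cong λ p q → cong (χ p q *_) (trans (∑-nbrs-J (λ y′ → (f (Y p q) - f y′) ²) v)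
      (∑²-cong λ p′ q′ → cong (χ p′ q′ *_)
        (solve 3 (λ y y′ v → (y :- y′) :* (y :- y′) := ((y :- v) :- (y′ :- v)) :* ((y :- v) :- (y′ :- v))) refl
               (f (Y p q)) (f (Y p′ q′)) (f v)))))

  Γ-link : Γ (J n k) f v ≡ ½ * energy
  Γ-link = cong (½ *_) (trans (∑-nbrs-J (λ y → (f v - f y) * (f v - f y)) v)
    (∑²-cong λ p q → cong (χ p q *_)
      (solve 2 (λ v y → (v :- y) :* (v :- y) := (y :- v) :* (y :- v)) refl (f v) (f (Y p q)))))

  Γ₂-gap : 4ℚ * Γ₂ (J n k) f v - 4ℚ * ((1ℚ + (ℤ.+ n) / 2) * Γ (J n k) f v) ≡ squares
  Γ₂-gap = begin
    4ℚ * Γ₂ (J n k) f v - 4ℚ * ((1ℚ + (ℤ.+ n) / 2) * Γ (J n k) f v)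
      ≡⟨ cong₂ _-_ (trans (four-Γ₂ f v) (cong₂ _-_ twoStepSum-link pairSum-link))
                   (trans (cong (λ g → 4ℚ * ((1ℚ + (ℤ.+ n) / 2) * g)) Γ-link) (4*[1+n/2]*½≡2+n n energy)) ⟩
    twoStepSum - pairSum - (2ℚ + fromℕ n) * energy
      ≡⟨ cong (λ N → twoStepSum - pairSum - (2ℚ + N) * energy) (∑-1 n) ⟨
    twoStepSum - pairSum - (2ℚ + ∑[ i < n ] 1ℚ) * energy
      ≡⟨ sum-of-squares ⟩
    squares ∎
    where
    open ≡-Reasoning
    open RegularGraph (J n k) (fromℕ k * (fromℕ n - fromℕ k)) degree-J

J-CD : ∀ n k → CD (J n k) (1ℚ + (ℤ.+ n) / 2)
J-CD n k f v = ≤-from-gap (subst (0ℚ ≤_) (sym Γ₂-gap) squares-nonneg)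
  where open AtVertex f v

ones-first : ∀ {n k} → k ℕ.≤ n → Vec Bool n
ones-first {zero}  {zero}  z≤n       = []
ones-first {suc n} {zero}  z≤n       = false ∷ ones-first {n} z≤n
ones-first {suc n} {suc k} (s≤s k≤n) = true ∷ ones-first k≤n

weight-ones-first : ∀ {n k} (k≤n : k ℕ.≤ n) → weight (ones-first k≤n) ≡ k
weight-ones-first {zero}  {zero}  z≤n       = refl
weight-ones-first {suc n} {zero}  z≤n       = weight-ones-first {n} z≤n
weight-ones-first {suc n} {suc k} (s≤s k≤n) = cong suc (weight-ones-first k≤n)

module Extremal {n k : ℕ} (k≤n : k ℕ.≤ n) where

  v₀ : Vertex n k
  v₀ = ones-first k≤n , weight-ones-first k≤n

  f₀ : Vertex n k → ℚ
  f₀ u = hamming (proj₁ v₀) (proj₁ u)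

  open AtVertex f₀ v₀

  a≡2 : ∀ {p q} → lookup x p ≡ true → lookup x q ≡ false → a p q ≡ 2ℚ
  a≡2 xp xq = cong₂ _-_ (hamming-swap x xp xq) (hamming-self x)

  W≡4 : ∀ {p q p′ q′} → DisjointSwaps x p q p′ q′ → W p q p′ q′ ≡ 2ℚ * 2ℚ
  W≡4 d = cong₂ _-_ (hamming-swap₂ d) (hamming-self x)

  Γ₂≡KΓ : Γ₂ (J n k) f₀ v₀ ≡ (1ℚ + (ℤ.+ n) / 2) * Γ (J n k) f₀ v₀
  Γ₂≡KΓ = ≡-from-gap (trans Γ₂-gap (squares-vanish 2ℚ a≡2 W≡4))

  Γ-value : Γ (J n k) f₀ v₀ ≡ ½ * (4ℚ * (fromℕ k * (fromℕ n - fromℕ k)))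
  Γ-value = trans Γ-link (cong (½ *_) (begin
    energy                               ≡⟨ ∑²-cong constant ⟩
    ∑² (λ p q → 4ℚ * (χ p q * 1ℚ))       ≡⟨ *-distribˡ-∑² 4ℚ (λ p q → χ p q * 1ℚ) ⟨
    4ℚ * ∑² (λ p q → χ p q * 1ℚ)         ≡⟨ cong (4ℚ *_) (trans (sym (∑-nbrs-J (λ _ → 1ℚ) v₀)) (degree-J v₀)) ⟩
    4ℚ * (fromℕ k * (fromℕ n - fromℕ k)) ∎))
    where
    open ≡-Reasoning
    constant : ∀ p q → χ p q * a p q ² ≡ 4ℚ * (χ p q * 1ℚ)
    constant p q = trans (⟦⟧²*-cong (lookup x p) (not (lookup x q)) λ xp xq → cong _² (a≡2 xp (not≡true⇒≡false xq)))
                         (solve 1 (λ c → c :* (con 2ℚ :* con 2ℚ) := con 4ℚ :* (c :* con 1ℚ)) refl (χ p q))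

J-maximal : ∀ {n k} → 1 ℕ.≤ k → k ℕ.< n → ∀ K′ → CD (J n k) K′ → K′ ≤ 1ℚ + (ℤ.+ n) / 2
J-maximal {n} {suc k} (s≤s z≤n) k<n K′ cd =
  ℚ.*-cancelʳ-≤-pos (Γ (J n (suc k)) f₀ v₀) {{positive Γ-pos}}
    (subst (K′ * Γ (J n (suc k)) f₀ v₀ ≤_) Γ₂≡KΓ (cd f₀ v₀))
  where
  open Extremal (ℕₚ.<⇒≤ k<n)
  Γ-pos : 0ℚ < Γ (J n (suc k)) f₀ v₀
  Γ-pos = subst (0ℚ <_) (sym Γ-value)
    (*-pos (ℚ.positive⁻¹ ½) (*-pos (ℚ.positive⁻¹ 4ℚ) (*-pos (fromℕ-pos k) (fromℕ-diff-pos k<n))))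

open import Data.Integer using (+_)

theorem9 : (n k : ℕ) → 2 ℕ.≤ n → 1 ℕ.≤ k → k ℕ.< n →
    IsRic (J n k) (1ℚ + (+ n) / 2)
theorem9 n k _ 1≤k k<n = J-CD n k , J-maximal 1≤k k<n  -- 2 ≤ n already follows from 1 ≤ k < n
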